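{- Let $K_{1,3}$ be the claw graph (one vertex adjacent to three pairwise non-adjacent vertices) and $K_4\setminus e$ the diamond graph ($K_4$ with one edge removed). Then $W[K_{1,3}]=W^*[K_{1,3}]=E[K_{1,3}]=4$ and $W[K_4\setminus e]=W^*[K_4\setminus e]=E[K_4\setminus e]=4$.
   Context: Graphs are finite, simple, undirected, loopless. First-order sentences about graphs use only adjacency $\sim$ and equality $=$. Write $F\sqsubset G$ if $G$ contains an induced copy of $F$. $W[F]$ is the minimum number of distinct variables in a first-order sentence $\Phi$ with $G\models\Phi$ iff $F\sqsubset G$ for all graphs $G$. For non-isomorphic $G,H$, $W(G,H)$ is the minimum number of distinct variables in a sentence true on one and false on the other; $W^*[F]=\max\{W(G,H):F\sqsubset G,\ F\not\sqsubset H\}$. For $k\ge2$, $\mathrm{EA}_k$ says: for all disjoint vertex sets $X,Y$ with $|X\cup Y|<k$ there is $z\notin X\cup Y$ adjacent to all of $X$ and to none of $Y$; $\mathrm{EA}_1$ says the graph is non-empty. The extension index $E[F]$ is the minimum $k$ such that every graph satisfying $\mathrm{EA}_k$ contains an induced copy of $F$. -}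

module Defs where

open import Data.Nat using (ℕ; zero; suc; _≤_; _<_; _≟_)
open import Data.Fin using (Fin; zero; suc)
open import Data.Fin.Subset using (Subset; _∈_; _∉_; _∪_; ∣_∣)
open import Data.Bool using (Bool; true; false; not; _∧_; if_then_else_)
open import Data.Maybe using (Maybe; just; nothing)
open import Data.List using (List; []; _∷_; _++_; length; deduplicate; filter)
open import Data.Bool.ListAction using (any)
open import Data.List.Relation.Unary.All using (All)
open import Data.Fin.Properties using () renaming (_≟_ to _≟ᶠ_)
open import Data.Vec.Functional using () renaming (Vector to Vec)
open import Data.List using () renaming (map to lmap)
open import Data.Fin using (toℕ)
open import Data.List using () renaming (allFin to allFinL)
open import Data.Product using (Σ; ∃; _×_; _,_)
open import Data.Empty using (⊥)
open import Function using (Injective; Bijective)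
open import Relation.Nullary using (¬_; Dec; yes; no)
open import Relation.Nullary.Decidable using (⌊_⌋)
open import Relation.Binary.PropositionalEquality using (_≡_; _≢_; refl)

record Graph : Set where
  field
    size  : ℕ
    adj   : Fin size → Fin size → Bool
    sym   : ∀ u v → adj u v ≡ adj v u
    irr   : ∀ v → adj v v ≡ false
open Graph public

_⊑_ : Graph → Graph → Set
F ⊑ G = Σ (Fin (size F) → Fin (size G)) λ f →
          Injective _≡_ _≡_ f × (∀ u v → adj G (f u) (f v) ≡ adj F u v)

_≅_ : Graph → Graph → Set
F ≅ G = Σ (Fin (size F) → Fin (size G)) λ f →
          Bijective _≡_ _≡_ f × (∀ u v → adj G (f u) (f v) ≡ adj F u v)

-- First-order logic of graphs, variables named by natural numbers.
-- Other connectives/quantifiers (∨, →, ∀) are definable from these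
-- without introducing new variables.

data Formula : Set where
  adjF : ℕ → ℕ → Formula
  eqF  : ℕ → ℕ → Formula
  negF : Formula → Formula
  andF : Formula → Formula → Formula
  exF  : ℕ → Formula → Formula

varList : Formula → List ℕ
varList (adjF x y) = x ∷ y ∷ []
varList (eqF x y)  = x ∷ y ∷ []
varList (negF φ)   = varList φ
varList (andF φ ψ) = varList φ ++ varList ψ
varList (exF x φ)  = x ∷ varList φ

numVars : Formula → ℕ
numVars φ = length (deduplicate _≟_ (varList φ))

freeVars : Formula → List ℕ
freeVars (adjF x y) = x ∷ y ∷ []
freeVars (eqF x y)  = x ∷ y ∷ []
freeVars (negF φ)   = freeVars φ
freeVars (andF φ ψ) = freeVars φ ++ freeVars ψ
freeVars (exF x φ)  = filter (λ y → Relation.Nullary.¬? (y ≟ x)) (freeVars φ)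

Sentence : Formula → Set
Sentence φ = freeVars φ ≡ []

-- Semantics (Bool-valued, the graphs being finite). Assignments are partial
-- so that the empty graph is handled; atoms with unassigned variables are false
-- (irrelevant for sentences).
Assignment : Graph → Set
Assignment G = ℕ → Maybe (Fin (size G))

update : {G : Graph} → Assignment G → ℕ → Fin (size G) → Assignment G
update σ x v y = if ⌊ y ≟ x ⌋ then just v else σ y

eval : (G : Graph) → Assignment G → Formula → Bool
eval G σ (adjF x y) with σ x | σ y
... | just u | just v = adj G u v
... | _      | _      = false
eval G σ (eqF x y) with σ x | σ y
... | just u | just v = ⌊ u ≟ᶠ v ⌋
... | _      | _      = false
eval G σ (negF φ)   = not (eval G σ φ)
eval G σ (andF φ ψ) = eval G σ φ ∧ eval G σ ψ
eval G σ (exF x φ)  = any (λ v → eval G (update {G} σ x v) φ) (allFinL (size G))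

_⊨_ : Graph → Formula → Set
G ⊨ φ = eval G (λ _ → nothing) φ ≡ true

DefinableWith : ℕ → Graph → Set
DefinableWith k F = Σ Formula λ φ → Sentence φ × numVars φ ≤ k ×
                      (∀ G → (G ⊨ φ → F ⊑ G) × (F ⊑ G → G ⊨ φ))

W≡ : Graph → ℕ → Set
W≡ F k = DefinableWith k F × (∀ j → j < k → ¬ DefinableWith j F)

DistinguishableWith : ℕ → Graph → Graph → Set
DistinguishableWith k G H = Σ Formula λ φ → Sentence φ × numVars φ ≤ k ×
                              (eval G (λ _ → nothing) φ ≢ eval H (λ _ → nothing) φ)

Wpair≡ : Graph → Graph → ℕ → Set
Wpair≡ G H k = DistinguishableWith k G H × (∀ j → j < k → ¬ DistinguishableWith j G H)

W*≡ : Graph → ℕ → Set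
W*≡ F k = (∀ G H → F ⊑ G → ¬ (F ⊑ H) → Σ ℕ λ m → Wpair≡ G H m × m ≤ k)
        × (Σ Graph λ G → Σ Graph λ H → F ⊑ G × ¬ (F ⊑ H) × Wpair≡ G H k)

EA : ℕ → Graph → Set
EA zero G = Data.Unit.⊤ where import Data.Unit
EA (suc zero) G = Fin (size G)      -- the graph is non-empty
EA (suc (suc k)) G =
  (X Y : Subset (size G)) → (∀ v → v ∈ X → v ∉ Y) → ∣ X ∪ Y ∣ < suc (suc k) →
  Σ (Fin (size G)) λ z → z ∉ X × z ∉ Y ×
    (∀ x → x ∈ X → adj G z x ≡ true) × (∀ y → y ∈ Y → adj G z y ≡ false)

ExtForces : ℕ → Graph → Set
ExtForces k F = ∀ G → EA k G → F ⊑ G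

E≡ : Graph → ℕ → Set
E≡ F k = ExtForces k F × (∀ j → j < k → ¬ ExtForces j F)

pattern v0 = zero
pattern v1 = suc zero
pattern v2 = suc (suc zero)
pattern v3 = suc (suc (suc zero))

clawAdj : Fin 4 → Fin 4 → Bool
clawAdj v0 v1 = true
clawAdj v0 v2 = true
clawAdj v0 v3 = true
clawAdj v1 v0 = true
clawAdj v2 v0 = true
clawAdj v3 v0 = true
clawAdj _  _  = false

diamondAdj : Fin 4 → Fin 4 → Bool
diamondAdj v0 v1 = true
diamondAdj v0 v2 = true
diamondAdj v0 v3 = true
diamondAdj v1 v0 = true
diamondAdj v1 v2 = true
diamondAdj v1 v3 = true
diamondAdj v2 v0 = true
diamondAdj v2 v1 = true
diamondAdj v3 v0 = true
diamondAdj v3 v1 = true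
diamondAdj _  _  = false

clawSym : ∀ u v → clawAdj u v ≡ clawAdj v u
clawSym v0 v0 = refl
clawSym v0 v1 = refl
clawSym v0 v2 = refl
clawSym v0 v3 = refl
clawSym v1 v0 = refl
clawSym v1 v1 = refl
clawSym v1 v2 = refl
clawSym v1 v3 = refl
clawSym v2 v0 = refl
clawSym v2 v1 = refl
clawSym v2 v2 = refl
clawSym v2 v3 = refl
clawSym v3 v0 = refl
clawSym v3 v1 = refl
clawSym v3 v2 = refl
clawSym v3 v3 = refl

clawIrr : ∀ v → clawAdj v v ≡ false
clawIrr v0 = refl
clawIrr v1 = refl
clawIrr v2 = refl
clawIrr v3 = refl

diamondSym : ∀ u v → diamondAdj u v ≡ diamondAdj v u
diamondSym v0 v0 = refl
diamondSym v0 v1 = refl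
diamondSym v0 v2 = refl
diamondSym v0 v3 = refl
diamondSym v1 v0 = refl
diamondSym v1 v1 = refl
diamondSym v1 v2 = refl
diamondSym v1 v3 = refl
diamondSym v2 v0 = refl
diamondSym v2 v1 = refl
diamondSym v2 v2 = refl
diamondSym v2 v3 = refl
diamondSym v3 v0 = refl
diamondSym v3 v1 = refl
diamondSym v3 v2 = refl
diamondSym v3 v3 = refl

diamondIrr : ∀ v → diamondAdj v v ≡ false
diamondIrr v0 = refl
diamondIrr v1 = refl
diamondIrr v2 = refl
diamondIrr v3 = refl

claw : Graph
claw = record { size = 4 ; adj = clawAdj ; sym = clawSym ; irr = clawIrr }

diamond : Graph
diamond = record { size = 4 ; adj = diamondAdj ; sym = diamondSym ; irr = diamondIrr }

-- Upper bounds: the existential closure of the diagram of a four-vertex graph F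
-- defines F-containment with four variables, and EA₄ builds a copy of F vertex by
-- vertex.  Lower bounds: the Paley graphs P₉ and P₁₃ both have the two-point
-- extension property, so Duplicator wins the 3-pebble game on them and P₉ satisfies
-- EA₃; yet P₁₃ contains the claw and the diamond while P₉ contains neither.  For W*
-- the minimum W(G, H) must actually be found, and it can be: k-variable
-- distinguishability is decidable, since Duplicator's winning positions form the
-- limit of a decreasing refinement of the finitely many positions, and when
-- Spoiler wins the refinement yields a separating formula.

module Submission where

open import Defs renaming (sym to adj-sym; irr to adj-irr)
open import Data.Bool using (Bool; true; false; not; _∧_; _∨_; _xor_; if_then_else_)
open import Data.Bool.ListAction using (all; any)
open import Data.Empty using (⊥; ⊥-elim)
open import Data.Fin using (Fin; zero; suc; toℕ; fromℕ<; #_)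
open import Data.Fin.Properties using (toℕ-injective; toℕ-fromℕ<; toℕ<n; pigeonhole; <-cmp) renaming (_≟_ to _≟ᶠ_)
open import Data.Fin.Subset using (Subset; inside; outside; ⁅_⁆; ∣_∣; _∪_) renaming (_∈_ to _∈ₛ_; ⊥ to ∅)
open import Data.Fin.Subset.Properties using (_∈?_; x∈p∪q⁺; x∈p∪q⁻; x∈⁅x⁆; x∈⁅y⁆⇒x≡y; ∉⊥; ∣⁅x⁆∣≡1; ∣⊥∣≡0; p⊆q⇒∣p∣≤∣q∣)
open import Data.List using (List; []; _∷_; _++_; length; map; deduplicate; cartesianProductWith; cartesianProduct; allFin)
open import Data.List.Membership.Propositional using (_∈_; _∉_)
open import Data.List.Membership.Propositional.Properties using (∈-++⁺ˡ; ∈-++⁺ʳ; ∈-++⁻; ∈-map⁺; ∈-allFin; ∈-filter⁻; ∈-deduplicate⁺; ∈-deduplicate⁻; ∈-cartesianProductWith⁺; ∈-cartesianProduct⁺; ∈-lookup)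
open import Data.List.Properties using (length-map)
open import Data.List.Relation.Unary.All as All using (All; []; _∷_)
open import Data.List.Relation.Unary.AllPairs using ([]; _∷_)
open import Data.List.Relation.Unary.Any using (here; there; index)
open import Data.List.Relation.Unary.Unique.Propositional using (Unique)
open import Data.List.Relation.Unary.Unique.DecPropositional.Properties using (deduplicate-!)
open import Data.Maybe using (Maybe; just; nothing; is-just)
open import Data.Maybe.Properties using (≡-dec)
open import Data.Nat using (ℕ; zero; suc; _+_; _∸_; _/_; _%_; _≡ᵇ_; _≤_; _<_; z≤n; s≤s; s≤s⁻¹; _≤?_) renaming (_≟_ to _≟ℕ_)
open import Data.Nat.Properties using (≤-trans; ≤-refl; n≤1+n; <-≤-trans; ≰⇒>; <⇒≢; +-suc; +-mono-≤)
open import Data.Product using (∃; _×_; _,_; proj₁; proj₂)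
open import Data.Sum using (_⊎_; inj₁; inj₂)
open import Data.Unit using (tt)
open import Data.Vec using (Vec; []; _∷_; lookup; tabulate; replicate; _[_]≔_)
import Data.Vec.Base as V
open import Data.Vec.Properties using (lookup∘update; lookup∘update′; lookup∘tabulate; lookup-replicate; tabulate∘lookup; tabulate-cong)
open import Function using (case_of_)
open import Relation.Binary.Definitions using (tri<; tri≈; tri>)
open import Relation.Binary.PropositionalEquality using (_≡_; _≢_; refl; sym; trans; cong; cong₂; subst; subst₂; _≗_; ≢-sym; module ≡-Reasoning)
open import Relation.Nullary using (¬_; Dec; yes; no; ¬?)
open import Relation.Nullary.Decidable using (⌊_⌋)
open ≡-Reasoning

∧-trueˡ : ∀ {a b} → a ∧ b ≡ true → a ≡ true
∧-trueˡ {true} _ = refl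

∧-trueʳ : ∀ {a b} → a ∧ b ≡ true → b ≡ true
∧-trueʳ {true} e = e

∧-true⁺ : ∀ {a b} → a ≡ true → b ≡ true → a ∧ b ≡ true
∧-true⁺ refl refl = refl

∧-false⁻ : ∀ a {b} → a ∧ b ≡ false → a ≡ false ⊎ b ≡ false
∧-false⁻ false _ = inj₁ refl
∧-false⁻ true e = inj₂ e

false≢true : false ≢ true
false≢true ()

modus-ponens : ∀ {a b} → a ≡ true → not a ∨ b ≡ true → b ≡ true
modus-ponens refl b = b

not-∨-false⁻ : ∀ {a b} → not a ∨ b ≡ false → a ≡ true × b ≡ false
not-∨-false⁻ {true} {false} _ = refl , refl

not-true⇒false : ∀ {a} → not a ≡ true → a ≡ false
not-true⇒false {false} _ = refl

¬true⇒false : ∀ {a} → a ≢ true → a ≡ false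
¬true⇒false {false} _ = refl
¬true⇒false {true} ne = ⊥-elim (ne refl)

true⇔true⇒≡ : ∀ {a b} → (a ≡ true → b ≡ true) → (b ≡ true → a ≡ true) → a ≡ b
true⇔true⇒≡ {true} a⇒b _ = sym (a⇒b refl)
true⇔true⇒≡ {false} {true} _ b⇒a = b⇒a refl
true⇔true⇒≡ {false} {false} _ _ = refl

⌊⌋-true : ∀ {P : Set} (d : Dec P) → P → ⌊ d ⌋ ≡ true
⌊⌋-true (yes _) _ = refl
⌊⌋-true (no ¬p) p = ⊥-elim (¬p p)

⌊⌋-false : ∀ {P : Set} (d : Dec P) → ¬ P → ⌊ d ⌋ ≡ false
⌊⌋-false (yes p) ¬p = ⊥-elim (¬p p)
⌊⌋-false (no _) _ = refl

⌊⌋-true⇒ : ∀ {P : Set} (d : Dec P) → ⌊ d ⌋ ≡ true → P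
⌊⌋-true⇒ (yes p) _ = p

_==_ : Bool → Bool → Bool
x == true = x
x == false = not x

==⇒≡ : ∀ x y → x == y ≡ true → x ≡ y
==⇒≡ true true _ = refl
==⇒≡ false false _ = refl

==-refl : ∀ x → x == x ≡ true
==-refl true = refl
==-refl false = refl

≡⇒== : ∀ {x y} → x ≡ y → x == y ≡ true
≡⇒== {x} refl = ==-refl x

≢⇒==-false : ∀ x y → x ≢ y → y == x ≡ false
≢⇒==-false true true ne = ⊥-elim (ne refl)
≢⇒==-false true false _ = refl
≢⇒==-false false true _ = refl
≢⇒==-false false false ne = ⊥-elim (ne refl)

==-false⇒≢ : ∀ x y → x == y ≡ false → x ≢ y
==-false⇒≢ true .true () refl
==-false⇒≢ false .false () refl

module _ {A : Set} (p : A → Bool) where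

  all-true⁻ : ∀ xs → all p xs ≡ true → ∀ {x} → x ∈ xs → p x ≡ true
  all-true⁻ (y ∷ xs) e (here refl) = ∧-trueˡ e
  all-true⁻ (y ∷ xs) e (there x∈) = all-true⁻ xs (∧-trueʳ {p y} e) x∈

  all-true⁺ : ∀ xs → (∀ {x} → x ∈ xs → p x ≡ true) → all p xs ≡ true
  all-true⁺ [] _ = refl
  all-true⁺ (y ∷ xs) h = ∧-true⁺ (h (here refl)) (all-true⁺ xs (λ x∈ → h (there x∈)))

  all-false⁻ : ∀ xs → all p xs ≡ false → ∃ λ x → x ∈ xs × p x ≡ false
  all-false⁻ (y ∷ xs) e with p y in py
  ... | false = y , here refl , py
  ... | true with all-false⁻ xs e
  ... | x , x∈ , px = x , there x∈ , px

  any-true⁻ : ∀ xs → any p xs ≡ true → ∃ λ x → x ∈ xs × p x ≡ true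
  any-true⁻ (y ∷ xs) e with p y in py
  ... | true = y , here refl , py
  ... | false with any-true⁻ xs e
  ... | x , x∈ , px = x , there x∈ , px

  any-true⁺ : ∀ {x xs} → x ∈ xs → p x ≡ true → any p xs ≡ true
  any-true⁺ {xs = y ∷ xs} (here refl) px rewrite px = refl
  any-true⁺ {xs = y ∷ xs} (there x∈) px with p y
  ... | true = refl
  ... | false = any-true⁺ x∈ px

  any-false⁺ : ∀ xs → (∀ {x} → x ∈ xs → p x ≡ false) → any p xs ≡ false
  any-false⁺ [] _ = refl
  any-false⁺ (y ∷ xs) h rewrite h (here refl) = any-false⁺ xs (λ x∈ → h (there x∈))

  any-false⁻ : ∀ xs → any p xs ≡ false → ∀ {x} → x ∈ xs → p x ≡ false
  any-false⁻ xs e x∈ = ¬true⇒false (λ px → false≢true (trans (sym e) (any-true⁺ x∈ px)))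

any-allFin⁻ : ∀ {n} {p : Fin n → Bool} → any p (allFin n) ≡ true → ∃ λ i → p i ≡ true
any-allFin⁻ {n} {p} e with any-true⁻ p (allFin n) e
... | i , _ , pi = i , pi

any-cong : ∀ {A : Set} {p q : A → Bool} → p ≗ q → ∀ xs → any p xs ≡ any q xs
any-cong p≗q [] = refl
any-cong p≗q (x ∷ xs) = cong₂ _∨_ (p≗q x) (any-cong p≗q xs)

Enumerates : ∀ {A : Set} → List A → Set
Enumerates {A} xs = ∀ (x : A) → x ∈ xs

all-enumerates : ∀ {A : Set} (p : A → Bool) {xs} → Enumerates xs → all p xs ≡ true → ∀ x → p x ≡ true
all-enumerates p {xs} enum e x = all-true⁻ p xs e (enum x)

maybes : ∀ n → List (Maybe (Fin n))
maybes n = nothing ∷ map just (allFin n)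

maybes-enumerates : ∀ n → Enumerates (maybes n)
maybes-enumerates n nothing = here refl
maybes-enumerates n (just x) = there (∈-map⁺ just (∈-allFin x))

vectors : ∀ {A : Set} k → List A → List (Vec A k)
vectors zero xs = [] ∷ []
vectors (suc k) xs = cartesianProductWith _∷_ xs (vectors k xs)

vectors-enumerates : ∀ {A : Set} k {xs : List A} → Enumerates xs → Enumerates (vectors k xs)
vectors-enumerates zero enum [] = here refl
vectors-enumerates (suc k) enum (x ∷ v) = ∈-cartesianProductWith⁺ _∷_ (enum x) (vectors-enumerates k enum v)

adjMaybe : (G : Graph) → Maybe (Fin (size G)) → Maybe (Fin (size G)) → Bool
adjMaybe G (just u) (just v) = adj G u v
adjMaybe G _ _ = false

eqMaybe : ∀ {n} → Maybe (Fin n) → Maybe (Fin n) → Bool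
eqMaybe (just u) (just v) = ⌊ u ≟ᶠ v ⌋
eqMaybe _ _ = false

eval-adjF : ∀ G σ x y → eval G σ (adjF x y) ≡ adjMaybe G (σ x) (σ y)
eval-adjF G σ x y with σ x | σ y
... | just u | just v = refl
... | just u | nothing = refl
... | nothing | _ = refl

eval-eqF : ∀ G σ x y → eval G σ (eqF x y) ≡ eqMaybe (σ x) (σ y)
eval-eqF G σ x y with σ x | σ y
... | just u | just v = refl
... | just u | nothing = refl
... | nothing | _ = refl

adjMaybe-sym : ∀ G a b → adjMaybe G a b ≡ adjMaybe G b a
adjMaybe-sym G (just u) (just v) = adj-sym G u v
adjMaybe-sym G (just u) nothing = refl
adjMaybe-sym G nothing (just v) = refl
adjMaybe-sym G nothing nothing = refl

eqMaybe-sym : ∀ {n} (a b : Maybe (Fin n)) → eqMaybe a b ≡ eqMaybe b a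
eqMaybe-sym (just u) (just v) with u ≟ᶠ v | v ≟ᶠ u
... | yes _ | yes _ = refl
... | no _ | no _ = refl
... | yes e | no ne = ⊥-elim (ne (sym e))
... | no ne | yes e = ⊥-elim (ne (sym e))
eqMaybe-sym (just u) nothing = refl
eqMaybe-sym nothing (just v) = refl
eqMaybe-sym nothing nothing = refl

eqMaybe-refl : ∀ {n} (v : Fin n) → eqMaybe (just v) (just v) ≡ true
eqMaybe-refl v = ⌊⌋-true (v ≟ᶠ v) refl

eqMaybe-true⇒ : ∀ {n} (a b : Maybe (Fin n)) → eqMaybe a b ≡ true → ∃ λ s → a ≡ just s × b ≡ just s
eqMaybe-true⇒ (just u) (just v) e with ⌊⌋-true⇒ (u ≟ᶠ v) e
... | refl = u , refl , refl

adjMaybe-true⇒defined : ∀ G (a b : Maybe (Fin (size G))) → adjMaybe G a b ≡ true → is-just a ≡ true × is-just b ≡ true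
adjMaybe-true⇒defined G (just u) (just v) _ = refl , refl

eqMaybe-true⇒defined : ∀ {n} (a b : Maybe (Fin n)) → eqMaybe a b ≡ true → is-just a ≡ true × is-just b ≡ true
eqMaybe-true⇒defined (just u) (just v) _ = refl , refl

update-same : ∀ {G} (σ : Assignment G) x v → update {G} σ x v x ≡ just v
update-same σ x v rewrite ⌊⌋-true (x ≟ℕ x) refl = refl

update-other : ∀ {G} (σ : Assignment G) {x y} v → y ≢ x → update {G} σ x v y ≡ σ y
update-other σ {x} {y} v y≢x rewrite ⌊⌋-false (y ≟ℕ x) y≢x = refl

eval-cong : ∀ G {σ τ : Assignment G} → σ ≗ τ → ∀ φ → eval G σ φ ≡ eval G τ φ
eval-cong G {σ} {τ} σ≗τ (adjF x y) =
  trans (eval-adjF G σ x y) (trans (cong₂ (adjMaybe G) (σ≗τ x) (σ≗τ y)) (sym (eval-adjF G τ x y)))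
eval-cong G {σ} {τ} σ≗τ (eqF x y) =
  trans (eval-eqF G σ x y) (trans (cong₂ eqMaybe (σ≗τ x) (σ≗τ y)) (sym (eval-eqF G τ x y)))
eval-cong G σ≗τ (negF φ) = cong not (eval-cong G σ≗τ φ)
eval-cong G σ≗τ (andF φ ψ) = cong₂ _∧_ (eval-cong G σ≗τ φ) (eval-cong G σ≗τ ψ)
eval-cong G {σ} {τ} σ≗τ (exF x φ) = any-cong (λ v → eval-cong G (updated v) φ) (allFin (size G))
  where
  updated : ∀ v → update {G} σ x v ≗ update {G} τ x v
  updated v y with ⌊ y ≟ℕ x ⌋
  ... | true = refl
  ... | false = σ≗τ y

eval-exF⁻ : ∀ G σ x φ → eval G σ (exF x φ) ≡ true → ∃ λ v → eval G (update {G} σ x v) φ ≡ true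
eval-exF⁻ G σ x φ e = any-allFin⁻ e

eval-exF⁺ : ∀ G σ x φ v → eval G (update {G} σ x v) φ ≡ true → eval G σ (exF x φ) ≡ true
eval-exF⁺ G σ x φ v = any-true⁺ _ (∈-allFin v)

eval-exF-false⁺ : ∀ G σ x φ → (∀ v → eval G (update {G} σ x v) φ ≡ false) → eval G σ (exF x φ) ≡ false
eval-exF-false⁺ G σ x φ h = any-false⁺ _ (allFin (size G)) (λ {v} _ → h v)

-- The language has no ⊤, so a finite conjunction is closed off by a base formula.

andAll : ∀ m → (Fin m → Formula) → Formula → Formula
andAll zero f b = b
andAll (suc m) f b = andF (f zero) (andAll m (λ j → f (suc j)) b)

eval-andAll-true⁺ : ∀ G σ m f b → (∀ j → eval G σ (f j) ≡ true) → eval G σ b ≡ true → eval G σ (andAll m f b) ≡ true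
eval-andAll-true⁺ G σ zero f b h hb = hb
eval-andAll-true⁺ G σ (suc m) f b h hb = ∧-true⁺ (h zero) (eval-andAll-true⁺ G σ m (λ j → f (suc j)) b (λ j → h (suc j)) hb)

eval-andAll-false⁺ : ∀ G σ m f b j → eval G σ (f j) ≡ false → eval G σ (andAll m f b) ≡ false
eval-andAll-false⁺ G σ (suc m) f b zero e rewrite e = refl
eval-andAll-false⁺ G σ (suc m) f b (suc j) e with eval G σ (f zero)
... | true = eval-andAll-false⁺ G σ m (λ j → f (suc j)) b j e
... | false = refl

eval-andAll-true⁻ : ∀ G σ m f b → eval G σ (andAll m f b) ≡ true → ∀ j → eval G σ (f j) ≡ true
eval-andAll-true⁻ G σ (suc m) f b e zero = ∧-trueˡ e
eval-andAll-true⁻ G σ (suc m) f b e (suc j) = eval-andAll-true⁻ G σ m (λ j → f (suc j)) b (∧-trueʳ {eval G σ (f zero)} e) j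

andAll-occurrence : ∀ (vars : Formula → List ℕ) → (∀ φ ψ → vars (andF φ ψ) ≡ vars φ ++ vars ψ) →
                    ∀ m f b {a} → a ∈ vars (andAll m f b) → (∃ λ j → a ∈ vars (f j)) ⊎ a ∈ vars b
andAll-occurrence vars vars-andF zero f b a∈ = inj₂ a∈
andAll-occurrence vars vars-andF (suc m) f b a∈
  with ∈-++⁻ (vars (f zero)) (subst (_ ∈_) (vars-andF (f zero) (andAll m (λ j → f (suc j)) b)) a∈)
... | inj₁ a∈f = inj₁ (zero , a∈f)
... | inj₂ a∈rest with andAll-occurrence vars vars-andF m (λ j → f (suc j)) b a∈rest
... | inj₁ (j , a∈fj) = inj₁ (suc j , a∈fj)
... | inj₂ a∈b = inj₂ a∈b

-- The k-pebble game

Config : Graph → ℕ → Set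
Config G k = Vec (Maybe (Fin (size G))) k

noPebbles : ∀ {n} k → Vec (Maybe (Fin n)) k
noPebbles k = replicate k nothing

lookup-noPebbles : ∀ {n} k i → lookup (noPebbles {n} k) i ≡ nothing
lookup-noPebbles k i = lookup-replicate i nothing

place : ∀ {n k} → Vec (Maybe (Fin n)) k → Fin k → Fin n → Vec (Maybe (Fin n)) k
place c i v = c [ i ]≔ just v

lookup-extensionality : ∀ {A : Set} {k} (u v : Vec A k) → (∀ i → lookup u i ≡ lookup v i) → u ≡ v
lookup-extensionality u v h = trans (sym (tabulate∘lookup u)) (trans (tabulate-cong h) (tabulate∘lookup v))

AgreeAt : (G H : Graph) {k : ℕ} → Config G k → Config H k → Fin k → Fin k → Set
AgreeAt G H c c' i j = adjMaybe G (lookup c i) (lookup c j) ≡ adjMaybe H (lookup c' i) (lookup c' j)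
                     × eqMaybe (lookup c i) (lookup c j) ≡ eqMaybe (lookup c' i) (lookup c' j)

record PartialIso (G H : Graph) {k : ℕ} (c : Config G k) (c' : Config H k) : Set where
  constructor agreeing
  field
    agree : ∀ i j → AgreeAt G H c c' i j
open PartialIso

PartialIso-sym : ∀ G H {k} {c : Config G k} {c' : Config H k} → PartialIso G H c c' → PartialIso H G c' c
PartialIso-sym G H iso = agreeing λ i j → sym (proj₁ (agree iso i j)) , sym (proj₂ (agree iso i j))

noPebbles-PartialIso : ∀ G H k → PartialIso G H {k} (noPebbles k) (noPebbles k)
noPebbles-PartialIso G H k = agreeing λ i j →
  empty (lookup-noPebbles k i) (lookup-noPebbles k j) (lookup-noPebbles k i) (lookup-noPebbles k j)
  where
  empty : ∀ {a b a' b'} → a ≡ nothing → b ≡ nothing → a' ≡ nothing → b' ≡ nothing →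
          (adjMaybe G a b ≡ adjMaybe H a' b') × (eqMaybe a b ≡ eqMaybe a' b')
  empty refl refl refl refl = refl , refl

-- A winning strategy for Duplicator in the k-pebble game on G and H.
record Bisimulation (G H : Graph) (k : ℕ) : Set₁ where
  field
    Related : Config G k → Config H k → Set
    partialIso : ∀ {c c'} → Related c c' → PartialIso G H c c'
    forth : ∀ {c c'} → Related c c' → ∀ i v → ∃ λ w → Related (place c i v) (place c' i w)
    back : ∀ {c c'} → Related c c' → ∀ i w → ∃ λ v → Related (place c i v) (place c' i w)

-- The variables of a formula are listed without repetition; pebble m carries the m-th of them.

readAt : ∀ {V : Set} → List ℕ → ℕ → (ℕ → Maybe V) → Maybe V
readAt [] n σ = nothing
readAt (x ∷ xs) zero σ = σ x
readAt (x ∷ xs) (suc n) σ = readAt xs n σ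

position : ∀ {x : ℕ} {xs} → x ∈ xs → ℕ
position x∈ = toℕ (index x∈)

readAt-position : ∀ {V : Set} {x L} (x∈ : x ∈ L) (σ : ℕ → Maybe V) → readAt L (position x∈) σ ≡ σ x
readAt-position (here refl) σ = refl
readAt-position (there x∈) σ = readAt-position x∈ σ

readAt-nothing : ∀ {V : Set} L n → readAt {V} L n (λ _ → nothing) ≡ nothing
readAt-nothing [] n = refl
readAt-nothing (x ∷ L) zero = refl
readAt-nothing (x ∷ L) (suc n) = readAt-nothing L n

module _ {G : Graph} (σ : Assignment G) {x : ℕ} (v : Fin (size G)) where

  readAt-update-∉ : ∀ {L} → x ∉ L → ∀ n → readAt L n (update {G} σ x v) ≡ readAt L n σ
  readAt-update-∉ {[]} x∉ n = refl
  readAt-update-∉ {y ∷ L} x∉ zero = update-other {G} σ v (λ y≡x → x∉ (here (sym y≡x)))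
  readAt-update-∉ {y ∷ L} x∉ (suc n) = readAt-update-∉ (λ x∈ → x∉ (there x∈)) n

  readAt-update-other : ∀ {L} → Unique L → (x∈ : x ∈ L) → ∀ n → n ≢ position x∈ →
                        readAt L n (update {G} σ x v) ≡ readAt L n σ
  readAt-update-other (_ ∷ _) (here refl) zero n≢ = ⊥-elim (n≢ refl)
  readAt-update-other (fresh ∷ _) (here refl) (suc n) _ = readAt-update-∉ (λ x∈ → All.lookup fresh x∈ refl) n
  readAt-update-other (fresh ∷ _) (there x∈) zero _ = update-other {G} σ v (All.lookup fresh x∈)
  readAt-update-other (_ ∷ unique) (there x∈) (suc n) n≢ = readAt-update-other unique x∈ n (λ e → n≢ (cong suc e))

configOf : ∀ {V : Set} k → List ℕ → (ℕ → Maybe V) → Vec (Maybe V) k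
configOf k L σ = tabulate (λ i → readAt L (toℕ i) σ)

lookup-configOf : ∀ {V : Set} {k L x} (x∈ : x ∈ L) (x<k : position x∈ < k) (σ : ℕ → Maybe V) →
                  lookup (configOf k L σ) (fromℕ< x<k) ≡ σ x
lookup-configOf {L = L} x∈ x<k σ = begin
  lookup (configOf _ L σ) (fromℕ< x<k)   ≡⟨ lookup∘tabulate _ (fromℕ< x<k) ⟩
  readAt L (toℕ (fromℕ< x<k)) σ          ≡⟨ cong (λ n → readAt L n σ) (toℕ-fromℕ< x<k) ⟩
  readAt L (position x∈) σ               ≡⟨ readAt-position x∈ σ ⟩
  σ _                                    ∎

configOf-update : ∀ {G} k (σ : Assignment G) x v {L} → Unique L → (x∈ : x ∈ L) (x<k : position x∈ < k) →
                  configOf k L (update {G} σ x v) ≡ place (configOf k L σ) (fromℕ< x<k) v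
configOf-update {G} k σ x v {L} unique x∈ x<k = lookup-extensionality _ _ pointwise
  where
  pointwise : ∀ i → lookup (configOf k L (update {G} σ x v)) i ≡ lookup (place (configOf k L σ) (fromℕ< x<k) v) i
  pointwise i with i ≟ᶠ fromℕ< x<k
  ... | yes refl = trans (lookup-configOf x∈ x<k (update {G} σ x v))
                         (trans (update-same {G} σ x v) (sym (lookup∘update (fromℕ< x<k) (configOf k L σ) (just v))))
  ... | no i≢ = begin
    lookup (configOf k L (update {G} σ x v)) i ≡⟨ lookup∘tabulate _ i ⟩
    readAt L (toℕ i) (update {G} σ x v)        ≡⟨ readAt-update-other {G} σ v unique x∈ (toℕ i) toℕi≢ ⟩
    readAt L (toℕ i) σ                         ≡⟨ lookup∘tabulate _ i ⟨
    lookup (configOf k L σ) i                  ≡⟨ lookup∘update′ i≢ (configOf k L σ) (just v) ⟨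
    lookup (place (configOf k L σ) (fromℕ< x<k) v) i ∎
    where
    toℕi≢ : toℕ i ≢ position x∈
    toℕi≢ e = i≢ (toℕ-injective (trans e (sym (toℕ-fromℕ< x<k))))

module _ {G H : Graph} {k : ℕ} (bisim : Bisimulation G H k) where
  open Bisimulation bisim

  module _ (L : List ℕ) (unique : Unique L) (short : length L ≤ k) where

    slot : ∀ {x} (x∈ : x ∈ L) → position x∈ < k
    slot x∈ = ≤-trans (toℕ<n (index x∈)) short

    read : ∀ {V : Set} {x} (x∈ : x ∈ L) (σ : ℕ → Maybe V) → lookup (configOf k L σ) (fromℕ< (slot x∈)) ≡ σ x
    read x∈ = lookup-configOf x∈ (slot x∈)

    related⇒agree : ∀ φ → (∀ {a} → a ∈ varList φ → a ∈ L) → ∀ σ τ →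
                    Related (configOf k L σ) (configOf k L τ) → eval G σ φ ≡ eval H τ φ
    related⇒agree (adjF x y) ⊆L σ τ r = begin
      eval G σ (adjF x y)                   ≡⟨ eval-adjF G σ x y ⟩
      adjMaybe G (σ x) (σ y)                ≡⟨ cong₂ (adjMaybe G) (read x∈ σ) (read y∈ σ) ⟨
      adjMaybe G (lookup c (fromℕ< (slot x∈))) (lookup c (fromℕ< (slot y∈))) ≡⟨ proj₁ (agree (partialIso r) _ _) ⟩
      adjMaybe H (lookup c' (fromℕ< (slot x∈))) (lookup c' (fromℕ< (slot y∈))) ≡⟨ cong₂ (adjMaybe H) (read x∈ τ) (read y∈ τ) ⟩
      adjMaybe H (τ x) (τ y)                ≡⟨ eval-adjF H τ x y ⟨
      eval H τ (adjF x y)                   ∎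
      where
      x∈ = ⊆L (here refl)
      y∈ = ⊆L (there (here refl))
      c = configOf k L σ
      c' = configOf k L τ
    related⇒agree (eqF x y) ⊆L σ τ r = begin
      eval G σ (eqF x y)                    ≡⟨ eval-eqF G σ x y ⟩
      eqMaybe (σ x) (σ y)                   ≡⟨ cong₂ eqMaybe (read x∈ σ) (read y∈ σ) ⟨
      eqMaybe (lookup c (fromℕ< (slot x∈))) (lookup c (fromℕ< (slot y∈))) ≡⟨ proj₂ (agree (partialIso r) _ _) ⟩
      eqMaybe (lookup c' (fromℕ< (slot x∈))) (lookup c' (fromℕ< (slot y∈))) ≡⟨ cong₂ eqMaybe (read x∈ τ) (read y∈ τ) ⟩
      eqMaybe (τ x) (τ y)                   ≡⟨ eval-eqF H τ x y ⟨
      eval H τ (eqF x y)                    ∎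
      where
      x∈ = ⊆L (here refl)
      y∈ = ⊆L (there (here refl))
      c = configOf k L σ
      c' = configOf k L τ
    related⇒agree (negF φ) ⊆L σ τ r = cong not (related⇒agree φ ⊆L σ τ r)
    related⇒agree (andF φ ψ) ⊆L σ τ r =
      cong₂ _∧_ (related⇒agree φ (λ a∈ → ⊆L (∈-++⁺ˡ a∈)) σ τ r) (related⇒agree ψ (λ a∈ → ⊆L (∈-++⁺ʳ (varList φ) a∈)) σ τ r)
    related⇒agree (exF x φ) ⊆L σ τ r = true⇔true⇒≡ forthᵉ backᵉ
      where
      x∈ = ⊆L (here refl)
      i = fromℕ< (slot x∈)
      ⊆L′ : ∀ {a} → a ∈ varList φ → a ∈ L
      ⊆L′ a∈ = ⊆L (there a∈)
      move : ∀ v w → Related (place (configOf k L σ) i v) (place (configOf k L τ) i w) →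
             eval G (update {G} σ x v) φ ≡ eval H (update {H} τ x w) φ
      move v w r′ = related⇒agree φ ⊆L′ _ _ (subst₂ Related (sym (configOf-update {G} k σ x v unique x∈ (slot x∈)))
                                                            (sym (configOf-update {H} k τ x w unique x∈ (slot x∈))) r′)
      forthᵉ : eval G σ (exF x φ) ≡ true → eval H τ (exF x φ) ≡ true
      forthᵉ e with eval-exF⁻ G σ x φ e
      ... | v , ev with forth r i v
      ... | w , r′ = eval-exF⁺ H τ x φ w (trans (sym (move v w r′)) ev)
      backᵉ : eval H τ (exF x φ) ≡ true → eval G σ (exF x φ) ≡ true
      backᵉ e with eval-exF⁻ H τ x φ e
      ... | w , ew with back r i w
      ... | v , r′ = eval-exF⁺ G σ x φ v (trans (move v w r′) ew)

  bisimilar⇒agree : Related (noPebbles k) (noPebbles k) → ∀ φ → numVars φ ≤ k →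
                    eval G (λ _ → nothing) φ ≡ eval H (λ _ → nothing) φ
  bisimilar⇒agree r φ few = related⇒agree L (deduplicate-! _≟ℕ_ (varList φ)) few φ (∈-deduplicate⁺ _≟ℕ_) _ _
                                (subst₂ Related (sym (empty G)) (sym (empty H)) r)
    where
    L : List ℕ
    L = deduplicate _≟ℕ_ (varList φ)
    empty : ∀ K → configOf k L (λ (_ : ℕ) → nothing {A = Fin (size K)}) ≡ noPebbles k
    empty K = lookup-extensionality _ _ λ i →
      trans (lookup∘tabulate _ i) (trans (readAt-nothing L (toℕ i)) (sym (lookup-noPebbles k i)))

  bisimilar⇒indistinguishable : Related (noPebbles k) (noPebbles k) → ∀ j → j ≤ k → ¬ DistinguishableWith j G H
  bisimilar⇒indistinguishable r j j≤k (φ , _ , few , differ) = differ (bisimilar⇒agree r φ (≤-trans few j≤k))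

-- Deciding k-variable distinguishability

count : ∀ {A : Set} → (A → Bool) → List A → ℕ
count p [] = 0
count p (x ∷ xs) = if p x then suc (count p xs) else count p xs

count-≤-length : ∀ {A : Set} (p : A → Bool) xs → count p xs ≤ length xs
count-≤-length p [] = z≤n
count-≤-length p (x ∷ xs) with p x
... | true = s≤s (count-≤-length p xs)
... | false = ≤-trans (count-≤-length p xs) (n≤1+n _)

module _ {A : Set} {p q : A → Bool} (p⇒q : ∀ x → p x ≡ true → q x ≡ true) where

  count-mono : ∀ xs → count p xs ≤ count q xs
  count-mono [] = z≤n
  count-mono (x ∷ xs) with p x in px | q x in qx
  ... | true | true = s≤s (count-mono xs)
  ... | true | false = ⊥-elim (false≢true (trans (sym qx) (p⇒q x px)))
  ... | false | true = ≤-trans (count-mono xs) (n≤1+n _)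
  ... | false | false = count-mono xs

  count-< : ∀ {x} xs → x ∈ xs → p x ≡ false → q x ≡ true → count p xs < count q xs
  count-< (y ∷ xs) (here refl) px qx rewrite px | qx = s≤s (count-mono xs)
  count-< (y ∷ xs) (there x∈) px qx with p y in py | q y in qy
  ... | true | true = s≤s (count-< xs x∈ px qx)
  ... | true | false = ⊥-elim (false≢true (trans (sym qy) (p⇒q y py)))
  ... | false | true = ≤-trans (count-< xs x∈ px qx) (n≤1+n _)
  ... | false | false = count-< xs x∈ px qx

lookup-unique : ∀ {A : Set} {xs : List A} → Unique xs → ∀ i j → Data.List.lookup xs i ≡ Data.List.lookup xs j → i ≡ j
lookup-unique (_ ∷ _) zero zero _ = refl
lookup-unique (fresh ∷ _) zero (suc j) e = ⊥-elim (All.lookup fresh (∈-lookup j) e)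
lookup-unique (fresh ∷ _) (suc i) zero e = ⊥-elim (All.lookup fresh (∈-lookup i) (sym e))
lookup-unique (_ ∷ unique) (suc i) (suc j) e = cong suc (lookup-unique unique i j e)

unique-bounded⇒length-≤ : ∀ k (xs : List ℕ) → Unique xs → (∀ {a} → a ∈ xs → a < k) → length xs ≤ k
unique-bounded⇒length-≤ k xs unique bounded with length xs ≤? k
... | yes short = short
... | no long with pigeonhole (≰⇒> long) (λ j → fromℕ< (bounded (∈-lookup j)))
... | i , j , i<j , same = ⊥-elim (<⇒≢ i<j (cong toℕ (lookup-unique unique i j (begin
  Data.List.lookup xs i ≡⟨ toℕ-fromℕ< (bounded (∈-lookup i)) ⟨
  toℕ (fromℕ< (bounded (∈-lookup i))) ≡⟨ cong toℕ same ⟩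
  toℕ (fromℕ< (bounded (∈-lookup j))) ≡⟨ toℕ-fromℕ< (bounded (∈-lookup j)) ⟩
  Data.List.lookup xs j ∎))))

pebbles : ∀ {V : Set} {k} → Vec (Maybe V) k → ℕ → Maybe V
pebbles [] n = nothing
pebbles (a ∷ c) zero = a
pebbles (a ∷ c) (suc n) = pebbles c n

pebbles-toℕ : ∀ {V : Set} {k} (c : Vec (Maybe V) k) i → pebbles c (toℕ i) ≡ lookup c i
pebbles-toℕ (a ∷ c) zero = refl
pebbles-toℕ (a ∷ c) (suc i) = pebbles-toℕ c i

pebbles-place-other : ∀ {n k} (c : Vec (Maybe (Fin n)) k) i v m → m ≢ toℕ i → pebbles (place c i v) m ≡ pebbles c m
pebbles-place-other (a ∷ c) zero v zero m≢ = ⊥-elim (m≢ refl)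
pebbles-place-other (a ∷ c) zero v (suc m) _ = refl
pebbles-place-other (a ∷ c) (suc i) v zero _ = refl
pebbles-place-other (a ∷ c) (suc i) v (suc m) m≢ = pebbles-place-other c i v m (λ e → m≢ (cong suc e))

pebbles-noPebbles : ∀ {n} k m → pebbles (noPebbles {n} k) m ≡ nothing
pebbles-noPebbles zero m = refl
pebbles-noPebbles (suc k) zero = refl
pebbles-noPebbles (suc k) (suc m) = pebbles-noPebbles k m

update-pebbles : ∀ (G : Graph) {k} (c : Config G k) i v → update {G} (pebbles c) (toℕ i) v ≗ pebbles (place c i v)
update-pebbles G c i v m with m ≟ℕ toℕ i
... | yes refl = sym (trans (pebbles-toℕ (place c i v) i) (lookup∘update i c (just v)))
... | no m≢ = sym (pebbles-place-other c i v m m≢)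

literal : Bool → Formula → Formula
literal true φ = φ
literal false φ = negF φ

eval-literal : ∀ G σ b φ → eval G σ (literal b φ) ≡ (eval G σ φ == b)
eval-literal G σ true φ = refl
eval-literal G σ false φ = refl

varList-literal : ∀ b φ → varList (literal b φ) ≡ varList φ
varList-literal true φ = refl
varList-literal false φ = refl

freeVars-literal : ∀ b φ → freeVars (literal b φ) ≡ freeVars φ
freeVars-literal true φ = refl
freeVars-literal false φ = refl

∈-pair : ∀ {a x y : ℕ} → a ∈ x ∷ y ∷ [] → a ≡ x ⊎ a ≡ y
∈-pair (here e) = inj₁ e
∈-pair (there (here e)) = inj₂ e

module Game (G H : Graph) (k : ℕ) where

  nG nH : ℕ
  nG = size G
  nH = size H

  agreeAt : Config G k → Config H k → Fin k → Fin k → Bool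
  agreeAt c c' i j = (adjMaybe G (lookup c i) (lookup c j) == adjMaybe H (lookup c' i) (lookup c' j))
                   ∧ (eqMaybe (lookup c i) (lookup c j) == eqMaybe (lookup c' i) (lookup c' j))

  atomsAgree : Config G k → Config H k → Bool
  atomsAgree c c' = all (λ i → all (agreeAt c c' i) (allFin k)) (allFin k)

  survives : ℕ → Config G k → Config H k → Bool
  forthMoves backMoves : ℕ → Config G k → Config H k → Bool

  survives zero c c' = atomsAgree c c'
  survives (suc d) c c' = survives d c c' ∧ (forthMoves d c c' ∧ backMoves d c c')

  forthMoves d c c' =
    all (λ i → all (λ v → any (λ w → survives d (place c i v) (place c' i w)) (allFin nH)) (allFin nG)) (allFin k)
  backMoves d c c' =
    all (λ i → all (λ w → any (λ v → survives d (place c i v) (place c' i w)) (allFin nG)) (allFin nH)) (allFin k)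

  survives-suc⇒ : ∀ d c c' → survives (suc d) c c' ≡ true → survives d c c' ≡ true
  survives-suc⇒ d c c' = ∧-trueˡ

  survives⇒PartialIso : ∀ d c c' → survives d c c' ≡ true → PartialIso G H c c'
  survives⇒PartialIso zero c c' e = agreeing λ i j →
    ==⇒≡ _ _ (∧-trueˡ (entry i j)) ,
    ==⇒≡ _ _ (∧-trueʳ {adjMaybe G (lookup c i) (lookup c j) == adjMaybe H (lookup c' i) (lookup c' j)} (entry i j))
    where
    entry : ∀ i j → agreeAt c c' i j ≡ true
    entry i j = all-true⁻ (agreeAt c c' i) (allFin k) (all-true⁻ _ (allFin k) e (∈-allFin i)) (∈-allFin j)
  survives⇒PartialIso (suc d) c c' e = survives⇒PartialIso d c c' (survives-suc⇒ d c c' e)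

  Stable : ℕ → Set
  Stable d = ∀ c c' → survives d c c' ≡ true → survives (suc d) c c' ≡ true

  positions : List (Config G k × Config H k)
  positions = cartesianProduct (vectors k (maybes nG)) (vectors k (maybes nH))

  positions-enumerates : Enumerates positions
  positions-enumerates (c , c') =
    ∈-cartesianProduct⁺ (vectors-enumerates k (maybes-enumerates nG) c) (vectors-enumerates k (maybes-enumerates nH) c')

  survivors : ℕ → Config G k × Config H k → Bool
  survivors d (c , c') = survives d c c'

  -- The number of surviving positions decreases strictly until it stabilises.
  stabilise : ∀ fuel d → count (survivors d) positions < fuel → ∃ Stable
  stabilise (suc fuel) d bound with all (λ p → not (survivors d p) ∨ survivors (suc d) p) positions in stable?
  ... | true = d , λ c c' e → modus-ponens e (all-true⁻ _ positions stable? (positions-enumerates (c , c')))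
  ... | false with all-false⁻ _ positions stable?
  ... | p , p∈ , broken with not-∨-false⁻ broken
  ... | alive , dead = stabilise fuel (suc d)
        (<-≤-trans (count-< (λ { (c , c') → survives-suc⇒ d c c' }) positions p∈ dead alive) (s≤s⁻¹ bound))

  stable : ∃ Stable
  stable = stabilise (suc (length positions)) 0 (s≤s (count-≤-length _ positions))

  stable⇒Bisimulation : ∀ d → Stable d → Bisimulation G H k
  stable⇒Bisimulation d st = record
    { Related = λ c c' → survives d c c' ≡ true
    ; partialIso = λ {c} {c'} → survives⇒PartialIso d c c'
    ; forth = λ {c} {c'} e i v →
        any-allFin⁻ (all-true⁻ _ (allFin nG) (all-true⁻ _ (allFin k) (forth c c' e) (∈-allFin i)) (∈-allFin v))
    ; back = λ {c} {c'} e i w →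
        any-allFin⁻ (all-true⁻ _ (allFin nH) (all-true⁻ _ (allFin k) (back c c' e) (∈-allFin i)) (∈-allFin w))
    }
    where
    forth : ∀ c c' → survives d c c' ≡ true → forthMoves d c c' ≡ true
    forth c c' e = ∧-trueˡ (∧-trueʳ {survives d c c'} (st c c' e))
    back : ∀ c c' → survives d c c' ≡ true → backMoves d c c' ≡ true
    back c c' e = ∧-trueʳ {forthMoves d c c'} (∧-trueʳ {survives d c c'} (st c c' e))

  SameDomain : Config G k → Config H k → Set
  SameDomain c c' = ∀ i → is-just (lookup c i) ≡ is-just (lookup c' i)

  SameDomain-place : ∀ {c c'} → SameDomain c c' → ∀ i v w → SameDomain (place c i v) (place c' i w)
  SameDomain-place {c} {c'} same i v w j with j ≟ᶠ i
  ... | yes refl = trans (cong is-just (lookup∘update i c (just v))) (sym (cong is-just (lookup∘update i c' (just w))))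
  ... | no j≢i = trans (cong is-just (lookup∘update′ j≢i c (just v)))
                       (trans (same j) (sym (cong is-just (lookup∘update′ j≢i c' (just w)))))

  record Separation (c : Config G k) (c' : Config H k) : Set where
    field
      formula : Formula
      true-in-G : eval G (pebbles c) formula ≡ true
      false-in-H : eval H (pebbles c') formula ≡ false
      vars< : ∀ {a} → a ∈ varList formula → a < k
      free-placed : ∀ {a} → a ∈ freeVars formula → is-just (pebbles c a) ≡ true
  open Separation

  pair< : ∀ (i j : Fin k) {a} → a ∈ toℕ i ∷ toℕ j ∷ [] → a < k
  pair< i j a∈ with ∈-pair a∈
  ... | inj₁ refl = toℕ<n i
  ... | inj₂ refl = toℕ<n j

  eval-pebbles-adjF : ∀ {K} (d : Config K k) i j →
                      eval K (pebbles d) (adjF (toℕ i) (toℕ j)) ≡ adjMaybe K (lookup d i) (lookup d j)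
  eval-pebbles-adjF {K} d i j =
    trans (eval-adjF K (pebbles d) (toℕ i) (toℕ j)) (cong₂ (adjMaybe K) (pebbles-toℕ d i) (pebbles-toℕ d j))

  eval-pebbles-eqF : ∀ {K} (d : Config K k) i j →
                     eval K (pebbles d) (eqF (toℕ i) (toℕ j)) ≡ eqMaybe (lookup d i) (lookup d j)
  eval-pebbles-eqF {K} d i j =
    trans (eval-eqF K (pebbles d) (toℕ i) (toℕ j)) (cong₂ eqMaybe (pebbles-toℕ d i) (pebbles-toℕ d j))

  record Atom (i j : Fin k) : Set₁ where
    field
      atom : Formula
      varList-atom : varList atom ≡ toℕ i ∷ toℕ j ∷ []
      freeVars-atom : freeVars atom ≡ toℕ i ∷ toℕ j ∷ []
      atom-placed : ∀ {K} (d : Config K k) → eval K (pebbles d) atom ≡ true →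
                    is-just (lookup d i) ≡ true × is-just (lookup d j) ≡ true

  adjAtom : ∀ i j → Atom i j
  adjAtom i j = record
    { atom = adjF (toℕ i) (toℕ j) ; varList-atom = refl ; freeVars-atom = refl
    ; atom-placed = λ {K} d e → adjMaybe-true⇒defined K (lookup d i) (lookup d j) (trans (sym (eval-pebbles-adjF d i j)) e)
    }

  eqAtom : ∀ i j → Atom i j
  eqAtom i j = record
    { atom = eqF (toℕ i) (toℕ j) ; varList-atom = refl ; freeVars-atom = refl
    ; atom-placed = λ {K} d e → eqMaybe-true⇒defined (lookup d i) (lookup d j) (trans (sym (eval-pebbles-eqF d i j)) e)
    }

  atomSeparation : ∀ {c c'} → SameDomain c c' → ∀ {i j} (α : Atom i j) →
                   eval G (pebbles c) (Atom.atom α) ≢ eval H (pebbles c') (Atom.atom α) → Separation c c'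
  atomSeparation {c} {c'} same {i} {j} α differ = record
    { formula = literal b φ
    ; true-in-G = trans (eval-literal G _ b φ) (==-refl b)
    ; false-in-H = trans (eval-literal H _ b φ) (≢⇒==-false b _ differ)
    ; vars< = λ a∈ → pair< i j (subst (_ ∈_) (trans (varList-literal b φ) (varList-atom)) a∈)
    ; free-placed = λ a∈ → placed (subst (_ ∈_) (trans (freeVars-literal b φ) freeVars-atom) a∈)
    }
    where
    open Atom α
    φ : Formula
    φ = atom
    b : Bool
    b = eval G (pebbles c) φ
    placedᴳ : is-just (lookup c i) ≡ true × is-just (lookup c j) ≡ true
    placedᴳ with b in eb
    ... | true = atom-placed c eb
    ... | false with eval H (pebbles c') φ in eh
    ... | true = trans (same i) (proj₁ (atom-placed c' eh)) , trans (same j) (proj₂ (atom-placed c' eh))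
    ... | false = ⊥-elim (differ refl)
    placed : ∀ {a} → a ∈ toℕ i ∷ toℕ j ∷ [] → is-just (pebbles c a) ≡ true
    placed a∈ with ∈-pair a∈
    ... | inj₁ refl = trans (cong is-just (pebbles-toℕ c i)) (proj₁ placedᴳ)
    ... | inj₂ refl = trans (cong is-just (pebbles-toℕ c j)) (proj₂ placedᴳ)

  atomsDisagree⇒Separation : ∀ {c c'} → SameDomain c c' → atomsAgree c c' ≡ false → Separation c c'
  atomsDisagree⇒Separation {c} {c'} same disagree
    with all-false⁻ _ (allFin k) disagree
  ... | i , _ , disagreeᵢ with all-false⁻ _ (allFin k) disagreeᵢ
  ... | j , _ , disagreeᵢⱼ
    with ∧-false⁻ (adjMaybe G (lookup c i) (lookup c j) == adjMaybe H (lookup c' i) (lookup c' j)) disagreeᵢⱼ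
  ... | inj₁ adj≢ = atomSeparation same (adjAtom i j) λ e →
          ==-false⇒≢ _ _ adj≢ (trans (sym (eval-pebbles-adjF c i j)) (trans e (eval-pebbles-adjF c' i j)))
  ... | inj₂ eq≢ = atomSeparation same (eqAtom i j) λ e →
          ==-false⇒≢ _ _ eq≢ (trans (sym (eval-pebbles-eqF c i j)) (trans e (eval-pebbles-eqF c' i j)))

  -- ∃ xᵢ. ⋀ₘ f m; the closing conjunct xᵢ = xᵢ holds once xᵢ is bound.
  existsAll : Fin k → ∀ n → (Fin n → Formula) → Formula
  existsAll i n f = exF (toℕ i) (andAll n f (eqF (toℕ i) (toℕ i)))

  eval-existsAll-true : ∀ {K} (c : Config K k) i {n} f v → (∀ m → eval K (pebbles (place c i v)) (f m) ≡ true) →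
                        eval K (pebbles c) (existsAll i n f) ≡ true
  eval-existsAll-true {K} c i {n} f v h = eval-exF⁺ K (pebbles c) (toℕ i) body v
    (trans (eval-cong K (update-pebbles K c i v) body)
           (eval-andAll-true⁺ K _ n f (eqF (toℕ i) (toℕ i)) h
             (trans (eval-pebbles-eqF (place c i v) i i) (placed-self (lookup∘update i c (just v))))))
    where
    body : Formula
    body = andAll n f (eqF (toℕ i) (toℕ i))
    placed-self : ∀ {a} → a ≡ just v → eqMaybe a a ≡ true
    placed-self refl = eqMaybe-refl v

  eval-existsAll-false : ∀ {K} (c : Config K k) i {n} f → (∀ v → ∃ λ m → eval K (pebbles (place c i v)) (f m) ≡ false) →
                         eval K (pebbles c) (existsAll i n f) ≡ false
  eval-existsAll-false {K} c i {n} f h = eval-exF-false⁺ K (pebbles c) (toℕ i) body λ v →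
    trans (eval-cong K (update-pebbles K c i v) body)
          (eval-andAll-false⁺ K _ n f (eqF (toℕ i) (toℕ i)) (proj₁ (h v)) (proj₂ (h v)))
    where
    body : Formula
    body = andAll n f (eqF (toℕ i) (toℕ i))

  existsAll-vars< : ∀ i {n} f → (∀ m {a} → a ∈ varList (f m) → a < k) → ∀ {a} → a ∈ varList (existsAll i n f) → a < k
  existsAll-vars< i f _ (here refl) = toℕ<n i
  existsAll-vars< i {n} f bounded (there a∈) with andAll-occurrence varList (λ _ _ → refl) n f _ a∈
  ... | inj₁ (m , a∈m) = bounded m a∈m
  ... | inj₂ a∈i = pair< i i a∈i

  existsAll-placed : ∀ (c : Config G k) i {n} f → (∀ m {a} → a ∈ freeVars (f m) → a ≢ toℕ i → is-just (pebbles c a) ≡ true) →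
                     ∀ {a} → a ∈ freeVars (existsAll i n f) → is-just (pebbles c a) ≡ true
  existsAll-placed c i {n} f placed a∈ with ∈-filter⁻ (λ y → ¬? (y ≟ℕ toℕ i)) {xs = freeVars (andAll n f _)} a∈
  ... | a∈body , a≢i with andAll-occurrence freeVars (λ _ _ → refl) n f _ a∈body
  ... | inj₁ (m , a∈m) = placed m a∈m a≢i
  ... | inj₂ a∈i with ∈-pair a∈i
  ... | inj₁ a≡i = ⊥-elim (a≢i a≡i)
  ... | inj₂ a≡i = ⊥-elim (a≢i a≡i)

  placed-after-place : ∀ (c : Config G k) i v {a} → is-just (pebbles (place c i v) a) ≡ true → a ≢ toℕ i →
                       is-just (pebbles c a) ≡ true
  placed-after-place c i v {a} placed a≢i = trans (cong is-just (sym (pebbles-place-other c i v a a≢i))) placed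

  -- Spoiler places pebble i on v in G; every answer w in H is refuted.
  forthSeparation : ∀ c c' i v → (∀ w → Separation (place c i v) (place c' i w)) → Separation c c'
  forthSeparation c c' i v S = record
    { formula = existsAll i nH f
    ; true-in-G = eval-existsAll-true c i f v (λ w → true-in-G (S w))
    ; false-in-H = eval-existsAll-false c' i f (λ w → w , false-in-H (S w))
    ; vars< = existsAll-vars< i f (λ w → vars< (S w))
    ; free-placed = existsAll-placed c i f (λ w a∈ → placed-after-place c i v (free-placed (S w) a∈))
    }
    where
    f : Fin nH → Formula
    f w = formula (S w)

  -- Spoiler places pebble i on w in H; every answer v in G is refuted.
  backSeparation : ∀ c c' i w → (∀ v → Separation (place c i v) (place c' i w)) → Separation c c'
  backSeparation c c' i w S = record
    { formula = negF (existsAll i nG f)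
    ; true-in-G = cong not (eval-existsAll-false c i f (λ v → v , cong not (true-in-G (S v))))
    ; false-in-H = cong not (eval-existsAll-true c' i f w (λ v → cong not (false-in-H (S v))))
    ; vars< = existsAll-vars< i f (λ v → vars< (S v))
    ; free-placed = existsAll-placed c i f (λ v a∈ → placed-after-place c i v (free-placed (S v) a∈))
    }
    where
    f : Fin nG → Formula
    f v = negF (formula (S v))

  losing⇒Separation : ∀ d c c' → SameDomain c c' → survives d c c' ≡ false → Separation c c'
  losing⇒Separation zero c c' same lost = atomsDisagree⇒Separation same lost
  losing⇒Separation (suc d) c c' same lost with survives d c c' in alive
  ... | false = losing⇒Separation d c c' same alive
  ... | true with ∧-false⁻ (forthMoves d c c') lost
  ... | inj₁ noForth with all-false⁻ _ (allFin k) noForth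
  ... | i , _ , noForthᵢ with all-false⁻ _ (allFin nG) noForthᵢ
  ... | v , _ , refuted = forthSeparation c c' i v λ w →
          losing⇒Separation d _ _ (SameDomain-place {c} {c'} same i v w) (any-false⁻ _ (allFin nH) refuted (∈-allFin w))
  losing⇒Separation (suc d) c c' same lost | true | inj₂ noBack with all-false⁻ _ (allFin k) noBack
  ... | i , _ , noBackᵢ with all-false⁻ _ (allFin nH) noBackᵢ
  ... | w , _ , refuted = backSeparation c c' i w λ v →
          losing⇒Separation d _ _ (SameDomain-place {c} {c'} same i v w) (any-false⁻ _ (allFin nG) refuted (∈-allFin v))

  distinguishable? : Dec (DistinguishableWith k G H)
  distinguishable? with stable
  ... | d , st with survives d (noPebbles k) (noPebbles k) in alive
  ... | true = no (bisimilar⇒indistinguishable (stable⇒Bisimulation d st) alive k ≤-refl)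
  ... | false = yes (formula S , sentence , few , differ)
    where
    empty : SameDomain (noPebbles k) (noPebbles k)
    empty i = trans (cong is-just (lookup-noPebbles k i)) (sym (cong is-just (lookup-noPebbles k i)))
    S : Separation (noPebbles k) (noPebbles k)
    S = losing⇒Separation d _ _ empty alive
    sentence : Sentence (formula S)
    sentence with freeVars (formula S) in fv
    ... | [] = refl
    ... | a ∷ _ = ⊥-elim (false≢true (trans (sym (cong is-just (pebbles-noPebbles k a)))
                                             (free-placed S (subst (a ∈_) (sym fv) (here refl)))))
    few : numVars (formula S) ≤ k
    few = unique-bounded⇒length-≤ k _ (deduplicate-! _≟ℕ_ (varList (formula S)))
            (λ a∈ → vars< S (∈-deduplicate⁻ _≟ℕ_ (varList (formula S)) a∈))
    atNothing : ∀ K → eval K (λ _ → nothing) (formula S) ≡ eval K (pebbles (noPebbles k)) (formula S)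
    atNothing K = eval-cong K (λ m → sym (pebbles-noPebbles k m)) (formula S)
    differ : eval G (λ _ → nothing) (formula S) ≢ eval H (λ _ → nothing) (formula S)
    differ e = false≢true (begin
      false                                           ≡⟨ false-in-H S ⟨
      eval H (pebbles (noPebbles k)) (formula S)      ≡⟨ atNothing H ⟨
      eval H (λ _ → nothing) (formula S)              ≡⟨ e ⟨
      eval G (λ _ → nothing) (formula S)              ≡⟨ atNothing G ⟩
      eval G (pebbles (noPebbles k)) (formula S)      ≡⟨ true-in-G S ⟩
      true                                            ∎)

copyEntry : (F H : Graph) → (Fin (size F) → Fin (size H)) → Fin (size F) → Fin (size F) → Bool
copyEntry F H g p q = (⌊ g p ≟ᶠ g q ⌋ == ⌊ p ≟ᶠ q ⌋) ∧ (adj H (g p) (g q) == adj F p q)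

isCopy : (F H : Graph) → (Fin (size F) → Fin (size H)) → Bool
isCopy F H g = all (λ p → all (copyEntry F H g p) (allFin (size F))) (allFin (size F))

isCopy⁻ : ∀ F H g → isCopy F H g ≡ true → ∀ p q → copyEntry F H g p q ≡ true
isCopy⁻ F H g e p q = all-true⁻ (copyEntry F H g p) (allFin (size F))
  (all-true⁻ (λ p → all (copyEntry F H g p) (allFin (size F))) (allFin (size F)) e (∈-allFin p)) (∈-allFin q)

isCopy⁺ : ∀ F H g → (∀ p q → copyEntry F H g p q ≡ true) → isCopy F H g ≡ true
isCopy⁺ F H g entry = all-true⁺ (λ p → all (copyEntry F H g p) (allFin (size F))) (allFin (size F)) λ {p} _ →
                      all-true⁺ (copyEntry F H g p) (allFin (size F)) λ {q} _ → entry p q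

isCopy⇒⊑ : ∀ F H g → isCopy F H g ≡ true → F ⊑ H
isCopy⇒⊑ F H g e = g , injective , preserves
  where
  entry : ∀ p q → copyEntry F H g p q ≡ true
  entry = isCopy⁻ F H g e
  injective : ∀ {p q} → g p ≡ g q → p ≡ q
  injective {p} {q} gp≡gq =
    ⌊⌋-true⇒ (p ≟ᶠ q) (trans (sym (==⇒≡ _ _ (∧-trueˡ (entry p q)))) (⌊⌋-true (g p ≟ᶠ g q) gp≡gq))
  preserves : ∀ p q → adj H (g p) (g q) ≡ adj F p q
  preserves p q = ==⇒≡ _ _ (∧-trueʳ {⌊ g p ≟ᶠ g q ⌋ == ⌊ p ≟ᶠ q ⌋} (entry p q))

⊑⇒isCopy : ∀ F H (m : F ⊑ H) → isCopy F H (proj₁ m) ≡ true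
⊑⇒isCopy F H (g , injective , preserves) =
  isCopy⁺ F H g λ p q → ∧-true⁺ (≡⇒== (same-decision p q)) (≡⇒== (preserves p q))
  where
  same-decision : ∀ p q → ⌊ g p ≟ᶠ g q ⌋ ≡ ⌊ p ≟ᶠ q ⌋
  same-decision p q with p ≟ᶠ q
  ... | yes refl = ⌊⌋-true (g p ≟ᶠ g p) refl
  ... | no p≢q = ⌊⌋-false (g p ≟ᶠ g q) (λ e → p≢q (injective e))

-- Symmetry and irreflexivity reduce an induced copy to the pairs p < q.
upperTriangle⇒⊑ : ∀ F H (g : Fin (size F) → Fin (size H)) →
                  (∀ p q → p Data.Fin.< q → g p ≢ g q × adj H (g p) (g q) ≡ adj F p q) → F ⊑ H
upperTriangle⇒⊑ F H g pair = g , injective , preserves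
  where
  injective : ∀ {p q} → g p ≡ g q → p ≡ q
  injective {p} {q} e with <-cmp p q
  ... | tri< p<q _ _ = ⊥-elim (proj₁ (pair p q p<q) e)
  ... | tri≈ _ p≡q _ = p≡q
  ... | tri> _ _ q<p = ⊥-elim (proj₁ (pair q p q<p) (sym e))
  preserves : ∀ p q → adj H (g p) (g q) ≡ adj F p q
  preserves p q with <-cmp p q
  ... | tri< p<q _ _ = proj₂ (pair p q p<q)
  ... | tri≈ _ refl _ = trans (adj-irr H (g p)) (sym (adj-irr F p))
  ... | tri> _ _ q<p = trans (adj-sym H (g p) (g q)) (trans (proj₂ (pair q p q<p)) (adj-sym F q p))

-- The two-point extension property

Fits : (K : Graph) → Fin (size K) → Maybe (Fin (size K)) → Bool → Bool
Fits K z nothing p = true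
Fits K z (just u) p = not ⌊ z ≟ᶠ u ⌋ ∧ (adj K z u == p)

Compatible : ∀ {n} → Maybe (Fin n) → Bool → Maybe (Fin n) → Bool → Bool
Compatible (just u) p (just u′) p′ = not ⌊ u ≟ᶠ u′ ⌋ ∨ (p == p′)
Compatible _ _ _ _ = true

TwoExtension : Graph → Set
TwoExtension K = ∀ a p b q → Compatible a p b q ≡ true → ∃ λ z → Fits K z a p ≡ true × Fits K z b q ≡ true

bools : List Bool
bools = true ∷ false ∷ []

bools-enumerates : Enumerates bools
bools-enumerates true = here refl
bools-enumerates false = there (here refl)

twoExtensionAt : (K : Graph) → Maybe (Fin (size K)) → Bool → Maybe (Fin (size K)) → Bool → Bool
twoExtensionAt K a p b q = not (Compatible a p b q) ∨ any (λ z → Fits K z a p ∧ Fits K z b q) (allFin (size K))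

twoExtension? : Graph → Bool
twoExtension? K = all (λ a → all (λ p → all (λ b → all (twoExtensionAt K a p b) bools) ms) bools) ms
  where
  ms : List (Maybe (Fin (size K)))
  ms = maybes (size K)

twoExtension?-sound : ∀ K → twoExtension? K ≡ true → TwoExtension K
twoExtension?-sound K ok a p b q compatible with any-true⁻ _ (allFin (size K)) (modus-ponens compatible check)
  where
  ms : List (Maybe (Fin (size K)))
  ms = maybes (size K)
  ms-enum : Enumerates ms
  ms-enum = maybes-enumerates (size K)
  check : twoExtensionAt K a p b q ≡ true
  check = all-enumerates (twoExtensionAt K a p b) bools-enumerates
          (all-enumerates (λ b → all (twoExtensionAt K a p b) bools) ms-enum
          (all-enumerates (λ p → all (λ b → all (twoExtensionAt K a p b) bools) ms) bools-enumerates
          (all-enumerates (λ a → all (λ p → all (λ b → all (twoExtensionAt K a p b) bools) ms) bools) ms-enum ok a) p) b) q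
... | z , _ , fits = z , ∧-trueˡ fits , ∧-trueʳ {Fits K z a p} fits

Fits-just⇒ : ∀ K z u p → Fits K z (just u) p ≡ true → z ≢ u × adj K z u ≡ p
Fits-just⇒ K z u p fits =
  (λ z≡u → false≢true (trans (sym (cong not (⌊⌋-true (z ≟ᶠ u) z≡u))) (∧-trueˡ fits))) ,
  ==⇒≡ _ _ (∧-trueʳ {not ⌊ z ≟ᶠ u ⌋} fits)

eqMaybe-diagonal : ∀ {n} (a : Maybe (Fin n)) → eqMaybe a a ≡ is-just a
eqMaybe-diagonal (just u) = eqMaybe-refl u
eqMaybe-diagonal nothing = refl

eqMaybe-≢ : ∀ {n} {u v : Fin n} → u ≢ v → eqMaybe (just u) (just v) ≡ false
eqMaybe-≢ {u = u} {v} u≢v = ⌊⌋-false (u ≟ᶠ v) u≢v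

module _ {G H : Graph} {k : ℕ} where

  PartialIso-domain : ∀ {c : Config G k} {c' : Config H k} → PartialIso G H c c' →
                      ∀ q → is-just (lookup c q) ≡ is-just (lookup c' q)
  PartialIso-domain {c} {c'} iso q =
    trans (sym (eqMaybe-diagonal (lookup c q))) (trans (proj₂ (agree iso q q)) (eqMaybe-diagonal (lookup c' q)))

  SameRelation : Config G k → Config H k → Fin (size G) → Fin (size H) → Fin k → Set
  SameRelation c c' v w q = adjMaybe G (just v) (lookup c q) ≡ adjMaybe H (just w) (lookup c' q)
                          × eqMaybe (just v) (lookup c q) ≡ eqMaybe (just w) (lookup c' q)

  place-PartialIso : ∀ {c c'} → PartialIso G H c c' → ∀ i v w → (∀ q → q ≢ i → SameRelation c c' v w q) →
                     PartialIso G H (place c i v) (place c' i w)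
  place-PartialIso {c} {c'} iso i v w same = agreeing agreement
    where
    agreement : ∀ p q → AgreeAt G H (place c i v) (place c' i w) p q
    agreement p q with p ≟ᶠ i | q ≟ᶠ i
    ... | yes refl | yes refl rewrite lookup∘update p c (just v) | lookup∘update p c' (just w) =
          trans (adj-irr G v) (sym (adj-irr H w)) , trans (eqMaybe-refl v) (sym (eqMaybe-refl w))
    ... | yes refl | no q≢p rewrite lookup∘update p c (just v) | lookup∘update p c' (just w)
                                  | lookup∘update′ q≢p c (just v) | lookup∘update′ q≢p c' (just w) = same q q≢p
    ... | no p≢q | yes refl rewrite lookup∘update q c (just v) | lookup∘update q c' (just w)
                                  | lookup∘update′ p≢q c (just v) | lookup∘update′ p≢q c' (just w) =
          trans (adjMaybe-sym G (lookup c p) (just v)) (trans (proj₁ (same p p≢q)) (adjMaybe-sym H (just w) (lookup c' p))) ,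
          trans (eqMaybe-sym (lookup c p) (just v)) (trans (proj₂ (same p p≢q)) (eqMaybe-sym (just w) (lookup c' p)))
    ... | no p≢i | no q≢i rewrite lookup∘update′ p≢i c (just v) | lookup∘update′ p≢i c' (just w)
                                | lookup∘update′ q≢i c (just v) | lookup∘update′ q≢i c' (just w) = agree iso p q

  module _ {c : Config G k} {c' : Config H k} (iso : PartialIso G H c c') (v : Fin (size G)) where

    -- Spoiler put v under a pebble o that is already placed: answer with o's partner.
    copyPebble : ∀ o → lookup c o ≡ just v → ∃ λ w → ∀ q → SameRelation c c' v w q
    copyPebble o co with lookup c' o in c'o
    ... | nothing = ⊥-elim (false≢true (trans (sym (cong is-just c'o)) (trans (sym (PartialIso-domain iso o)) (cong is-just co))))
    ... | just w = w , λ q → transport q (agree iso o q)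
      where
      transport : ∀ q → AgreeAt G H c c' o q → SameRelation c c' v w q
      transport q rewrite co | c'o = λ agreement → agreement

    copyPebble-place : ∀ i o → lookup c o ≡ just v → ∃ λ w → PartialIso G H (place c i v) (place c' i w)
    copyPebble-place i o co with copyPebble o co
    ... | w , same = w , place-PartialIso iso i v w (λ q _ → same q)

    fits⇒SameRelation : ∀ z q → lookup c q ≢ just v → Fits H z (lookup c' q) (adjMaybe G (just v) (lookup c q)) ≡ true →
                        SameRelation c c' v z q
    fits⇒SameRelation z q = fits⇒related (lookup c q) (lookup c' q) (PartialIso-domain iso q)
      where
      fits⇒related : ∀ a a′ → is-just a ≡ is-just a′ → a ≢ just v → Fits H z a′ (adjMaybe G (just v) a) ≡ true →
                     adjMaybe G (just v) a ≡ adjMaybe H (just z) a′ × eqMaybe (just v) a ≡ eqMaybe (just z) a′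
      fits⇒related nothing nothing _ _ _ = refl , refl
      fits⇒related (just u) (just u′) _ fresh fits =
        sym (proj₂ (Fits-just⇒ H z u′ (adj G v u) fits)) ,
        trans (eqMaybe-≢ λ v≡u → fresh (cong just (sym v≡u))) (sym (eqMaybe-≢ (proj₁ (Fits-just⇒ H z u′ (adj G v u) fits))))

    requests-compatible : ∀ o o′ → Compatible (lookup c' o) (adjMaybe G (just v) (lookup c o))
                                               (lookup c' o′) (adjMaybe G (just v) (lookup c o′)) ≡ true
    requests-compatible o o′ with lookup c' o in c'o | lookup c' o′ in c'o′
    ... | nothing | _ = refl
    ... | just u | nothing = refl
    ... | just u | just u′ with u ≟ᶠ u′
    ... | no _ = refl
    ... | yes refl with eqMaybe-true⇒ (lookup c o) (lookup c o′)
                          (trans (proj₂ (agree iso o o′)) (trans (cong₂ eqMaybe c'o c'o′) (eqMaybe-refl u)))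
    ... | s , co , co′ rewrite co | co′ = ==-refl (adj G v s)

    -- If the pebbles other than i are among o₁ and o₂, a fresh answer need only
    -- match those two, which is what the two-point extension property provides.
    twoExtension⇒answer : TwoExtension H → ∀ i o₁ o₂ → (∀ q → q ≢ i → q ≡ o₁ ⊎ q ≡ o₂) →
                          ∃ λ w → PartialIso G H (place c i v) (place c' i w)
    twoExtension⇒answer extH i o₁ o₂ others with ≡-dec _≟ᶠ_ (lookup c o₁) (just v) | ≡-dec _≟ᶠ_ (lookup c o₂) (just v)
    ... | yes on₁ | _ = copyPebble-place i o₁ on₁
    ... | no _ | yes on₂ = copyPebble-place i o₂ on₂
    ... | no off₁ | no off₂
      with extH (lookup c' o₁) (adjMaybe G (just v) (lookup c o₁)) (lookup c' o₂) (adjMaybe G (just v) (lookup c o₂))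
                (requests-compatible o₁ o₂)
    ... | z , fits₁ , fits₂ = z , place-PartialIso iso i v z same
      where
      same : ∀ q → q ≢ i → SameRelation c c' v z q
      same q q≢i with others q q≢i
      ... | inj₁ refl = fits⇒SameRelation z q off₁ fits₁
      ... | inj₂ refl = fits⇒SameRelation z q off₂ fits₂

otherPebbles : Fin 3 → Fin 3 × Fin 3
otherPebbles v0 = v1 , v2
otherPebbles v1 = v0 , v2
otherPebbles v2 = v0 , v1

otherPebbles-cover : ∀ i q → q ≢ i → q ≡ proj₁ (otherPebbles i) ⊎ q ≡ proj₂ (otherPebbles i)
otherPebbles-cover v0 v0 q≢i = ⊥-elim (q≢i refl)
otherPebbles-cover v0 v1 _ = inj₁ refl
otherPebbles-cover v0 v2 _ = inj₂ refl
otherPebbles-cover v1 v0 _ = inj₁ refl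
otherPebbles-cover v1 v1 q≢i = ⊥-elim (q≢i refl)
otherPebbles-cover v1 v2 _ = inj₂ refl
otherPebbles-cover v2 v0 _ = inj₁ refl
otherPebbles-cover v2 v1 _ = inj₂ refl
otherPebbles-cover v2 v2 q≢i = ⊥-elim (q≢i refl)

twoExtension⇒forth : ∀ G H → TwoExtension H → ∀ {c : Config G 3} {c' : Config H 3} → PartialIso G H c c' →
                     ∀ i v → ∃ λ w → PartialIso G H (place c i v) (place c' i w)
twoExtension⇒forth G H extH iso i v =
  twoExtension⇒answer iso v extH i (proj₁ (otherPebbles i)) (proj₂ (otherPebbles i)) (otherPebbles-cover i)

twoExtension⇒Bisimulation : ∀ G H → TwoExtension G → TwoExtension H → Bisimulation G H 3
twoExtension⇒Bisimulation G H extG extH = record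
  { Related = PartialIso G H
  ; partialIso = λ iso → iso
  ; forth = twoExtension⇒forth G H extH
  ; back = λ iso i w → let (v , iso′) = twoExtension⇒forth H G extG (PartialIso-sym G H iso) i w
                       in v , PartialIso-sym H G iso′
  }

-- Extension axioms

size-∪ : ∀ {n} (p q : Subset n) → ∣ p ∪ q ∣ ≤ ∣ p ∣ + ∣ q ∣
size-∪ [] [] = z≤n
size-∪ (outside ∷ p) (outside ∷ q) = size-∪ p q
size-∪ (inside ∷ p) (outside ∷ q) = s≤s (size-∪ p q)
size-∪ (outside ∷ p) (inside ∷ q) = subst (suc ∣ p ∪ q ∣ ≤_) (sym (+-suc ∣ p ∣ ∣ q ∣)) (s≤s (size-∪ p q))
size-∪ (inside ∷ p) (inside ∷ q) = s≤s (≤-trans (size-∪ p q) (subst (∣ p ∣ + ∣ q ∣ ≤_) (sym (+-suc ∣ p ∣ ∣ q ∣)) (n≤1+n _)))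

subset⊆list : ∀ {n} (S : Subset n) → ∃ λ xs → length xs ≡ ∣ S ∣ × (∀ {x} → x ∈ₛ S → x ∈ xs)
subset⊆list [] = [] , refl , λ ()
subset⊆list (outside ∷ S) with subset⊆list S
... | xs , len , ⊆xs = map suc xs , trans (length-map suc xs) len , λ { (V.there x∈) → ∈-map⁺ suc (⊆xs x∈) }
subset⊆list (inside ∷ S) with subset⊆list S
... | xs , len , ⊆xs = zero ∷ map suc xs , cong suc (trans (length-map suc xs) len) ,
                       λ { V.here → here refl ; (V.there x∈) → there (∈-map⁺ suc (⊆xs x∈)) }

pairCover : ∀ {n} (S : Subset n) → ∣ S ∣ ≤ 2 →
            ∃ λ (a : Maybe (Fin n)) → ∃ λ b → ∀ {x} → x ∈ₛ S → a ≡ just x ⊎ b ≡ just x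
pairCover S small with subset⊆list S
... | [] , _ , ⊆xs = nothing , nothing , λ x∈ → case ⊆xs x∈ of λ ()
... | y ∷ [] , _ , ⊆xs = just y , nothing , λ x∈ → case ⊆xs x∈ of λ { (here refl) → inj₁ refl }
... | y ∷ y′ ∷ [] , _ , ⊆xs =
  just y , just y′ , λ x∈ → case ⊆xs x∈ of λ { (here refl) → inj₁ refl ; (there (here refl)) → inj₂ refl }
... | _ ∷ _ ∷ _ ∷ _ , len , _ with subst (_≤ 2) (sym len) small
... | s≤s (s≤s ())

twoExtension⇒EA₃ : ∀ K → TwoExtension K → EA 3 K
twoExtension⇒EA₃ K ext X Y disjoint small with pairCover (X ∪ Y) (s≤s⁻¹ small)
... | a , b , cover with ext a (inX a) b (inX b) (compatible a b)
  where
  inX : Maybe (Fin (size K)) → Bool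
  inX nothing = false
  inX (just x) = ⌊ x ∈? X ⌋
  compatible : ∀ a b → Compatible a (inX a) b (inX b) ≡ true
  compatible nothing _ = refl
  compatible (just x) nothing = refl
  compatible (just x) (just y) with x ≟ᶠ y
  ... | yes refl = ==-refl ⌊ x ∈? X ⌋
  ... | no _ = refl
... | z , fits-a , fits-b =
  z , (λ z∈X → proj₁ (at (x∈p∪q⁺ (inj₁ z∈X))) refl) ,
      (λ z∈Y → proj₁ (at (x∈p∪q⁺ (inj₂ z∈Y))) refl) ,
      (λ x x∈X → trans (proj₂ (at (x∈p∪q⁺ (inj₁ x∈X)))) (⌊⌋-true (x ∈? X) x∈X)) ,
      (λ y y∈Y → trans (proj₂ (at (x∈p∪q⁺ (inj₂ y∈Y)))) (⌊⌋-false (y ∈? X) (λ y∈X → disjoint y y∈X y∈Y)))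
  where
  at : ∀ {x} → x ∈ₛ X ∪ Y → z ≢ x × adj K z x ≡ ⌊ x ∈? X ⌋
  at x∈ with cover x∈
  ... | inj₁ refl = Fits-just⇒ K z _ _ fits-a
  ... | inj₂ refl = Fits-just⇒ K z _ _ fits-b

twoExtension⇒EA<4 : ∀ K → TwoExtension K → Fin (size K) → ∀ j → j < 4 → EA j K
twoExtension⇒EA<4 K ext v zero _ = tt
twoExtension⇒EA<4 K ext v (suc zero) _ = v
twoExtension⇒EA<4 K ext v (suc (suc zero)) _ X Y disjoint small = twoExtension⇒EA₃ K ext X Y disjoint (≤-trans small (n≤1+n _))
twoExtension⇒EA<4 K ext v (suc (suc (suc zero))) _ = twoExtension⇒EA₃ K ext
twoExtension⇒EA<4 K ext v (suc (suc (suc (suc j)))) (s≤s (s≤s (s≤s (s≤s ()))))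

Realises : (G : Graph) → Fin (size G) → Fin (size G) × Bool → Set
Realises G z (u , p) = z ≢ u × adj G z u ≡ p

requested : ∀ {n} → Bool → List (Fin n × Bool) → Subset n
requested b [] = ∅
requested b ((u , p) ∷ us) = if p == b then ⁅ u ⁆ ∪ requested b us else requested b us

∈-requested⁺ : ∀ {n} {x : Fin n} {b} us → (x , b) ∈ us → x ∈ₛ requested b us
∈-requested⁺ {x = x} {b} ((u , p) ∷ us) (here refl) rewrite ==-refl b = x∈p∪q⁺ (inj₁ (x∈⁅x⁆ x))
∈-requested⁺ {b = b} ((u , p) ∷ us) (there x∈) with p == b
... | true = x∈p∪q⁺ (inj₂ (∈-requested⁺ us x∈))
... | false = ∈-requested⁺ us x∈

∈-requested⁻ : ∀ {n} {x : Fin n} {b} us → x ∈ₛ requested b us → (x , b) ∈ us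
∈-requested⁻ [] x∈ = ⊥-elim (∉⊥ x∈)
∈-requested⁻ {b = b} ((u , p) ∷ us) x∈ with p == b in p==b
... | false = there (∈-requested⁻ us x∈)
... | true with x∈p∪q⁻ ⁅ u ⁆ _ x∈
... | inj₁ x∈u rewrite x∈⁅y⁆⇒x≡y u x∈u | ==⇒≡ p b p==b = here refl
... | inj₂ x∈rest = there (∈-requested⁻ us x∈rest)

vertices : ∀ {n} → List (Fin n × Bool) → Subset n
vertices [] = ∅
vertices ((u , _) ∷ us) = ⁅ u ⁆ ∪ vertices us

∈-vertices⁺ : ∀ {n} {x : Fin n} {p} us → (x , p) ∈ us → x ∈ₛ vertices us
∈-vertices⁺ {x = x} (_ ∷ us) (here refl) = x∈p∪q⁺ (inj₁ (x∈⁅x⁆ x))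
∈-vertices⁺ (_ ∷ us) (there x∈) = x∈p∪q⁺ (inj₂ (∈-vertices⁺ us x∈))

∣vertices∣≤length : ∀ {n} (us : List (Fin n × Bool)) → ∣ vertices us ∣ ≤ length us
∣vertices∣≤length {n} [] = subst (_≤ 0) (sym (∣⊥∣≡0 n)) z≤n
∣vertices∣≤length ((u , _) ∷ us) =
  ≤-trans (size-∪ ⁅ u ⁆ (vertices us)) (+-mono-≤ (subst (_≤ 1) (sym (∣⁅x⁆∣≡1 u)) ≤-refl) (∣vertices∣≤length us))

unique⇒functional : ∀ {n} {x : Fin n} {p q : Bool} (us : List (Fin n × Bool)) → Unique (map proj₁ us) →
                    (x , p) ∈ us → (x , q) ∈ us → p ≡ q
unique⇒functional (_ ∷ _) _ (here refl) (here refl) = refl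
unique⇒functional (_ ∷ us) (fresh ∷ _) (here refl) (there x∈) = ⊥-elim (All.lookup fresh (∈-map⁺ proj₁ x∈) refl)
unique⇒functional (_ ∷ us) (fresh ∷ _) (there x∈) (here refl) = ⊥-elim (All.lookup fresh (∈-map⁺ proj₁ x∈) refl)
unique⇒functional (_ ∷ us) (_ ∷ unique) (there x∈) (there x∈′) = unique⇒functional us unique x∈ x∈′

EA-realises : ∀ {m} G → EA (suc (suc m)) G → (us : List (Fin (size G) × Bool)) → Unique (map proj₁ us) →
              length us ≤ suc m → ∃ λ z → All (Realises G z) us
EA-realises G ea us unique short with ea X Y disjoint small
  where
  X Y : Subset (size G)
  X = requested true us
  Y = requested false us
  disjoint : ∀ v → v ∈ₛ X → ¬ v ∈ₛ Y
  disjoint v v∈X v∈Y = false≢true (sym (unique⇒functional us unique (∈-requested⁻ us v∈X) (∈-requested⁻ us v∈Y)))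
  covered : ∀ {v} → v ∈ₛ X ∪ Y → v ∈ₛ vertices us
  covered v∈ with x∈p∪q⁻ X Y v∈
  ... | inj₁ v∈X = ∈-vertices⁺ us (∈-requested⁻ us v∈X)
  ... | inj₂ v∈Y = ∈-vertices⁺ us (∈-requested⁻ us v∈Y)
  small : ∣ X ∪ Y ∣ < suc (suc _)
  small = s≤s (≤-trans (p⊆q⇒∣p∣≤∣q∣ covered) (≤-trans (∣vertices∣≤length us) short))
... | z , z∉X , z∉Y , adjX , adjY = z , All.tabulate realise
  where
  realise : ∀ {r} → r ∈ us → Realises G z r
  realise {u , true} u∈ = (λ { refl → z∉X (∈-requested⁺ us u∈) }) , adjX u (∈-requested⁺ us u∈)
  realise {u , false} u∈ = (λ { refl → z∉Y (∈-requested⁺ us u∈) }) , adjY u (∈-requested⁺ us u∈)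

module FourVertex (A : Fin 4 → Fin 4 → Bool) (A-sym : ∀ u v → A u v ≡ A v u) (A-irr : ∀ v → A v v ≡ false) where

  graph : Graph
  graph = record { size = 4 ; adj = A ; sym = A-sym ; irr = A-irr }

  quad : ∀ {V : Set} → V → V → V → V → Fin 4 → V
  quad a b c d v0 = a
  quad a b c d v1 = b
  quad a b c d v2 = c
  quad a b c d v3 = d

  quad-η : ∀ {V : Set} (f : Fin 4 → V) p → quad (f v0) (f v1) (f v2) (f v3) p ≡ f p
  quad-η f v0 = refl
  quad-η f v1 = refl
  quad-η f v2 = refl
  quad-η f v3 = refl

  ⊑⇒quadCopy : ∀ K (m : graph ⊑ K) → let f = proj₁ m in isCopy graph K (quad (f v0) (f v1) (f v2) (f v3)) ≡ true
  ⊑⇒quadCopy K (f , injective , preserves) = ⊑⇒isCopy graph K (_ , injective′ , preserves′)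
    where
    injective′ : ∀ {p q} → quad (f v0) (f v1) (f v2) (f v3) p ≡ quad (f v0) (f v1) (f v2) (f v3) q → p ≡ q
    injective′ {p} {q} e = injective (trans (sym (quad-η f p)) (trans e (quad-η f q)))
    preserves′ : ∀ p q → adj K (quad (f v0) (f v1) (f v2) (f v3) p) (quad (f v0) (f v1) (f v2) (f v3) q) ≡ A p q
    preserves′ p q rewrite quad-η f p | quad-η f q = preserves p q

  copyFree? : Graph → Bool
  copyFree? K = all (λ a → all (λ b → all (λ c → all (λ d → not (isCopy graph K (quad a b c d)))
                  (allFin (size K))) (allFin (size K))) (allFin (size K))) (allFin (size K))

  copyFree?-sound : ∀ K → copyFree? K ≡ true → ¬ graph ⊑ K
  copyFree?-sound K free m@(f , _) = false≢true (trans (sym (cong not (⊑⇒quadCopy K m))) noCopy)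
    where
    noCopy : not (isCopy graph K (quad (f v0) (f v1) (f v2) (f v3))) ≡ true
    noCopy = all-true⁻ _ _ (all-true⁻ _ _ (all-true⁻ _ _ (all-true⁻ _ _ free
               (∈-allFin (f v0))) (∈-allFin (f v1))) (∈-allFin (f v2))) (∈-allFin (f v3))

  entryFormula : Fin 4 → Fin 4 → Formula
  entryFormula p q = andF (literal ⌊ p ≟ᶠ q ⌋ (eqF (toℕ p) (toℕ q))) (literal (A p q) (adjF (toℕ p) (toℕ q)))

  row : Fin 4 → Formula
  row p = andAll 4 (entryFormula p) (eqF 0 0)

  matrix : Formula
  matrix = andAll 4 row (eqF 0 0)

  copyFormula : Formula
  copyFormula = exF 0 (exF 1 (exF 2 (exF 3 matrix)))

  quadAssignment : ∀ K → Fin (size K) → Fin (size K) → Fin (size K) → Fin (size K) → Assignment K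
  quadAssignment K a b c d = update {K} (update {K} (update {K} (update {K} (λ _ → nothing) 0 a) 1 b) 2 c) 3 d

  quadAssignment-toℕ : ∀ K a b c d p → quadAssignment K a b c d (toℕ p) ≡ just (quad a b c d p)
  quadAssignment-toℕ K a b c d v0 = refl
  quadAssignment-toℕ K a b c d v1 = refl
  quadAssignment-toℕ K a b c d v2 = refl
  quadAssignment-toℕ K a b c d v3 = refl

  module _ (K : Graph) (a b c d : Fin (size K)) where
    σ : Assignment K
    σ = quadAssignment K a b c d
    g : Fin 4 → Fin (size K)
    g = quad a b c d
    σ-at : ∀ p → σ (toℕ p) ≡ just (g p)
    σ-at = quadAssignment-toℕ K a b c d

    eval-entryFormula : ∀ p q → eval K σ (entryFormula p q) ≡ copyEntry graph K g p q
    eval-entryFormula p q = cong₂ _∧_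
      (begin
        eval K σ (literal ⌊ p ≟ᶠ q ⌋ (eqF (toℕ p) (toℕ q)))  ≡⟨ eval-literal K σ ⌊ p ≟ᶠ q ⌋ (eqF (toℕ p) (toℕ q)) ⟩
        eval K σ (eqF (toℕ p) (toℕ q)) == ⌊ p ≟ᶠ q ⌋          ≡⟨ cong (_== ⌊ p ≟ᶠ q ⌋) (eval-eqF K σ (toℕ p) (toℕ q)) ⟩
        eqMaybe (σ (toℕ p)) (σ (toℕ q)) == ⌊ p ≟ᶠ q ⌋         ≡⟨ cong₂ (λ x y → eqMaybe x y == ⌊ p ≟ᶠ q ⌋) (σ-at p) (σ-at q) ⟩
        ⌊ g p ≟ᶠ g q ⌋ == ⌊ p ≟ᶠ q ⌋                           ∎)
      (begin
        eval K σ (literal (A p q) (adjF (toℕ p) (toℕ q)))    ≡⟨ eval-literal K σ (A p q) (adjF (toℕ p) (toℕ q)) ⟩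
        eval K σ (adjF (toℕ p) (toℕ q)) == A p q             ≡⟨ cong (_== A p q) (eval-adjF K σ (toℕ p) (toℕ q)) ⟩
        adjMaybe K (σ (toℕ p)) (σ (toℕ q)) == A p q          ≡⟨ cong₂ (λ x y → adjMaybe K x y == A p q) (σ-at p) (σ-at q) ⟩
        adj K (g p) (g q) == A p q                           ∎)

    matrix⇒isCopy : eval K σ matrix ≡ true → isCopy graph K g ≡ true
    matrix⇒isCopy e = isCopy⁺ graph K g λ p q →
      trans (sym (eval-entryFormula p q))
            (eval-andAll-true⁻ K σ 4 (entryFormula p) (eqF 0 0) (eval-andAll-true⁻ K σ 4 row (eqF 0 0) e p) q)

    isCopy⇒matrix : isCopy graph K g ≡ true → eval K σ matrix ≡ true
    isCopy⇒matrix e = eval-andAll-true⁺ K σ 4 row (eqF 0 0) (λ p →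
      eval-andAll-true⁺ K σ 4 (entryFormula p) (eqF 0 0) (λ q → trans (eval-entryFormula p q) (isCopy⁻ graph K g e p q))
        (eqMaybe-refl a))
      (eqMaybe-refl a)

  copyFormula-defines : ∀ K → (K ⊨ copyFormula → graph ⊑ K) × (graph ⊑ K → K ⊨ copyFormula)
  copyFormula-defines K = sound , complete
    where
    none : Assignment K
    none _ = nothing
    sound : K ⊨ copyFormula → graph ⊑ K
    sound e with eval-exF⁻ K none 0 (exF 1 (exF 2 (exF 3 matrix))) e
    ... | a , ea with eval-exF⁻ K (update {K} none 0 a) 1 (exF 2 (exF 3 matrix)) ea
    ... | b , eb with eval-exF⁻ K (update {K} (update {K} none 0 a) 1 b) 2 (exF 3 matrix) eb
    ... | c , ec with eval-exF⁻ K (update {K} (update {K} (update {K} none 0 a) 1 b) 2 c) 3 matrix ec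
    ... | d , ed = isCopy⇒⊑ graph K (quad a b c d) (matrix⇒isCopy K a b c d ed)
    complete : graph ⊑ K → K ⊨ copyFormula
    complete m@(f , _) =
      eval-exF⁺ K none 0 (exF 1 (exF 2 (exF 3 matrix))) (f v0) (eval-exF⁺ K σ₁ 1 (exF 2 (exF 3 matrix)) (f v1)
        (eval-exF⁺ K σ₂ 2 (exF 3 matrix) (f v2) (eval-exF⁺ K σ₃ 3 matrix (f v3)
        (isCopy⇒matrix K (f v0) (f v1) (f v2) (f v3) (⊑⇒quadCopy K m)))))
      where
      σ₁ σ₂ σ₃ : Assignment K
      σ₁ = update {K} none 0 (f v0)
      σ₂ = update {K} σ₁ 1 (f v1)
      σ₃ = update {K} σ₂ 2 (f v2)

  -- Choose the vertices one at a time, each realising its adjacencies to the earlier ones.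
  EA₄⇒⊑ : ∀ G → EA 4 G → graph ⊑ G
  EA₄⇒⊑ G ea with EA-realises G ea [] [] z≤n
  ... | a , [] with EA-realises G ea ((a , A v1 v0) ∷ []) ([] ∷ []) (s≤s z≤n)
  ... | b , b-a ∷ [] with EA-realises G ea ((a , A v2 v0) ∷ (b , A v2 v1) ∷ [])
                            ((≢-sym (proj₁ b-a) ∷ []) ∷ [] ∷ []) (s≤s (s≤s z≤n))
  ... | c , c-a ∷ c-b ∷ [] with EA-realises G ea ((a , A v3 v0) ∷ (b , A v3 v1) ∷ (c , A v3 v2) ∷ [])
                                  ((≢-sym (proj₁ b-a) ∷ ≢-sym (proj₁ c-a) ∷ []) ∷ (≢-sym (proj₁ c-b) ∷ []) ∷ [] ∷ []) ≤-refl
  ... | d , d-a ∷ d-b ∷ d-c ∷ [] = upperTriangle⇒⊑ graph G (quad a b c d) pair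
    where
    earlier : ∀ {z u p q} → Realises G z (u , A q p) → u ≢ z × adj G u z ≡ A p q
    earlier (z≢u , zu) = ≢-sym z≢u , trans (adj-sym G _ _) (trans zu (A-sym _ _))
    pair : ∀ p q → p Data.Fin.< q → quad a b c d p ≢ quad a b c d q × adj G (quad a b c d p) (quad a b c d q) ≡ A p q
    pair v0 v1 _ = earlier b-a
    pair v0 v2 _ = earlier c-a
    pair v1 v2 _ = earlier c-b
    pair v0 v3 _ = earlier d-a
    pair v1 v3 _ = earlier d-b
    pair v2 v3 _ = earlier d-c
    pair v0 v0 ()
    pair v1 v0 ()
    pair v1 v1 (s≤s ())
    pair v2 v0 ()
    pair v2 v1 (s≤s ())
    pair v2 v2 (s≤s (s≤s ()))
    pair v3 v0 ()
    pair v3 v1 (s≤s ())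
    pair v3 v2 (s≤s (s≤s ()))
    pair v3 v3 (s≤s (s≤s (s≤s ())))

DistinguishableWith-mono : ∀ {j k G H} → j ≤ k → DistinguishableWith j G H → DistinguishableWith k G H
DistinguishableWith-mono j≤k (φ , sentence , few , differ) = φ , sentence , ≤-trans few j≤k , differ

least-distinguishing : ∀ G H k → DistinguishableWith k G H → ∃ λ m → Wpair≡ G H m × m ≤ k
least-distinguishing G H zero d = 0 , (d , λ _ ()) , z≤n
least-distinguishing G H (suc k) d with Game.distinguishable? G H k
... | yes d′ = let (m , least , m≤k) = least-distinguishing G H k d′ in m , least , ≤-trans m≤k (n≤1+n k)
... | no ¬d′ = suc k , (d , λ j j<1+k dⱼ → ¬d′ (DistinguishableWith-mono (s≤s⁻¹ j<1+k) dⱼ)) , ≤-refl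

definable⇒distinguishes : ∀ {k} F {G H} → DefinableWith k F → F ⊑ G → ¬ F ⊑ H → DistinguishableWith k G H
definable⇒distinguishes F {H = H} (φ , sentence , few , defines) F⊑G F⋢H =
  φ , sentence , few , λ same → F⋢H (proj₁ (defines H) (trans (sym same) (proj₂ (defines _) F⊑G)))

module Indices (F : Graph) (k : ℕ) (G₀ H₀ : Graph) (F⊑G₀ : F ⊑ G₀) (F⋢H₀ : ¬ F ⊑ H₀)
               (indistinguishable : ∀ j → j < k → ¬ DistinguishableWith j G₀ H₀) where

  W≡-intro : DefinableWith k F → W≡ F k
  W≡-intro definable = definable , λ j j<k definableⱼ →
    indistinguishable j j<k (definable⇒distinguishes F definableⱼ F⊑G₀ F⋢H₀)

  W*≡-intro : DefinableWith k F → W*≡ F k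
  W*≡-intro definable =
    (λ G H F⊑G F⋢H → least-distinguishing G H k (definable⇒distinguishes F definable F⊑G F⋢H)) ,
    (G₀ , H₀ , F⊑G₀ , F⋢H₀ , definable⇒distinguishes F definable F⊑G₀ F⋢H₀ , indistinguishable)

  E≡-intro : ExtForces k F → (∀ j → j < k → EA j H₀) → E≡ F k
  E≡-intro forced EA-H₀ = forced , λ j j<k forcedⱼ → F⋢H₀ (forcedⱼ H₀ (EA-H₀ j j<k))

-- Paley graphs

decidedGraph : ∀ n (A : Fin n → Fin n → Bool) →
               all (λ u → all (λ v → A u v == A v u) (allFin n)) (allFin n) ≡ true →
               all (λ v → not (A v v)) (allFin n) ≡ true → Graph
decidedGraph n A symmetric irreflexive = record
  { size = n
  ; adj = A
  ; sym = λ u v → ==⇒≡ _ _ (all-true⁻ (λ v → A u v == A v u) (allFin n)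
                    (all-true⁻ (λ u → all (λ v → A u v == A v u) (allFin n)) (allFin n) symmetric (∈-allFin u)) (∈-allFin v))
  ; irr = λ v → not-true⇒false (all-true⁻ (λ v → not (A v v)) (allFin n) irreflexive (∈-allFin v))
  }

-- Paley(9) as the 3 × 3 rook's graph: distinct cells are adjacent when they share a row or a column.
paley9 : Graph
paley9 = decidedGraph 9 (λ u v → ((toℕ u / 3) ≡ᵇ (toℕ v / 3)) xor ((toℕ u % 3) ≡ᵇ (toℕ v % 3))) refl refl

paley13 : Graph
paley13 = decidedGraph 13 (λ u v → square ((toℕ u + 13 ∸ toℕ v) % 13)) refl refl
  where
  square : ℕ → Bool
  square n = any (n ≡ᵇ_) (1 ∷ 3 ∷ 4 ∷ 9 ∷ 10 ∷ 12 ∷ [])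

paley-indistinguishable : ∀ j → j < 4 → ¬ DistinguishableWith j paley13 paley9
paley-indistinguishable j j<4 =
  bisimilar⇒indistinguishable
    (twoExtension⇒Bisimulation paley13 paley9 (twoExtension?-sound paley13 refl) (twoExtension?-sound paley9 refl))
    (noPebbles-PartialIso paley13 paley9 3) j (s≤s⁻¹ j<4)

paley9-EA<4 : ∀ j → j < 4 → EA j paley9
paley9-EA<4 = twoExtension⇒EA<4 paley9 (twoExtension?-sound paley9 refl) zero

module _ (A : Fin 4 → Fin 4 → Bool) (A-sym : ∀ u v → A u v ≡ A v u) (A-irr : ∀ v → A v v ≡ false) where
  open FourVertex A A-sym A-irr

  fourVertex-indices : Sentence copyFormula → numVars copyFormula ≤ 4 → graph ⊑ paley13 → ¬ graph ⊑ paley9 →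
                       W≡ graph 4 × W*≡ graph 4 × E≡ graph 4
  fourVertex-indices sentence few in13 out9 = W≡-intro definable , W*≡-intro definable , E≡-intro EA₄⇒⊑ paley9-EA<4
    where
    open Indices graph 4 paley13 paley9 in13 out9 paley-indistinguishable
    definable : DefinableWith 4 graph
    definable = copyFormula , sentence , few , copyFormula-defines

module Claw = FourVertex clawAdj clawSym clawIrr
module Diamond = FourVertex diamondAdj diamondSym diamondIrr

claw⊑paley13 : claw ⊑ paley13
claw⊑paley13 = isCopy⇒⊑ claw paley13 (Claw.quad (# 0) (# 1) (# 3) (# 9)) refl

claw⋢paley9 : ¬ claw ⊑ paley9
claw⋢paley9 = Claw.copyFree?-sound paley9 refl

diamond⊑paley13 : diamond ⊑ paley13
diamond⊑paley13 = isCopy⇒⊑ diamond paley13 (Diamond.quad (# 0) (# 1) (# 4) (# 10)) refl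

diamond⋢paley9 : ¬ diamond ⊑ paley9
diamond⋢paley9 = Diamond.copyFree?-sound paley9 refl

theorem4p8 : (W≡ claw 4 × W*≡ claw 4 × E≡ claw 4)
    × (W≡ diamond 4 × W*≡ diamond 4 × E≡ diamond 4)
theorem4p8 = fourVertex-indices clawAdj clawSym clawIrr refl ≤-refl claw⊑paley13 claw⋢paley9
           , fourVertex-indices diamondAdj diamondSym diamondIrr refl ≤-refl diamond⊑paley13 diamond⋢paley9
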